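{- Let $p$ be a prime, let $\zeta\in\mathbb{Q}$ be nonzero, written $\zeta=a/b$ with $a,b\in\mathbb{Z}$, $a>0$, $\gcd(a,b)=1$, and let $k\in\mathbb{Z}$ with $k>-\operatorname{ord}_p(\zeta)$. Then the following two procedures produce the same output (the same sequence of terms $q_0,q_1,\dots$): (1) Set $\zeta_0=\zeta$ and for $i\ge0$ while $\zeta_i\neq0$ let $t_i=\langle 1/\zeta_i\rangle_k$, $q_i=t_i+\left\lceil\frac{1-t_i\zeta_i}{p^k\zeta_i}\right\rceil p^k$, $\zeta_{i+1}=\zeta_i-1/q_i$, terminating if some $\zeta_N=0$. (2) Set $r_{ -1}=a$; for $i\ge0$ while $r_{i-1}\neq0$ let $q_i,r_i\in\mathbb{Z}[\tfrac1p]$ be the unique elements with $bq_0\cdots q_{i-1}=r_{i-1}q_i-r_i$ (left side $b$ when $i=0$), $0\le r_i<r_{i-1}p^k$ and $|r_i|_p\le|r_{i-1}p^k|_p$, terminating if some $r_N=0$.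
   Context: $\operatorname{ord}_p$ is the $p$-adic valuation and $|\cdot|_p$ the $p$-adic absolute value ($|x|_p=p^{ -\operatorname{ord}_p(x)}$, $|0|_p=0$). Every $\xi\in\mathbb{Q}_p^\times$ has a unique expansion $\xi=\sum_{n\ge \operatorname{ord}_p(\xi)} c_np^n$ with $c_n\in\{0,\dots,p-1\}$; define $\langle \xi\rangle_k=\sum_{n=\operatorname{ord}_p(\xi)}^{k-1}c_np^n$ (empty sum $0$). $\lceil x\rceil$ is the least integer $\ge x$. Procedure (1) is the paper's $p$-adic Sylvester algorithm with the embedding $\psi$ the inclusion $\mathbb{Q}\subset\mathbb{R}$; procedure (2) is its $p^k$-Greedy Algorithm (iterated $p^k$-division algorithm). -}

module Defs where

open import Data.Bool using (Bool; true; false; if_then_else_)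
open import Data.Nat as ℕ using (ℕ; zero; suc)
open import Data.Nat.Divisibility as ℕD using (divides)
open import Data.Integer as ℤ using (ℤ; +_; -[1+_])
open import Data.Rational as ℚ using (ℚ; 0ℚ; 1ℚ; ↥_; ↧ₙ_; _/_; 1/_; ceiling; _≤_; _<_; ≢-nonZero)
open import Data.Rational.Properties using (_≟_)
open import Data.Maybe using (Maybe; just; nothing)
open import Data.Product using (Σ; ∃; _×_)
open import Relation.Nullary using (yes; no; does; ¬_)
open import Relation.Binary.PropositionalEquality using (_≡_)

fromℤ : ℤ → ℚ
fromℤ z = z / 1

-- total inverse: 1/x for x ≠ 0, and (by convention) 0 at 0.
-- It is only ever applied to nonzero arguments in the procedures.
inv : ℚ → ℚ
inv x with x ≟ 0ℚ
... | yes _ = 0ℚ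
... | no x≢0 = 1/_ x {{≢-nonZero x≢0}}

powℕ : ℕ → ℕ → ℚ
powℕ p n = fromℤ (+ (p ℕ.^ n))

ppow : ℕ → ℤ → ℚ
ppow p (+ n)     = powℕ p n
ppow p -[1+ n ]  = inv (powℕ p (suc n))

sumTo : ℕ → (ℕ → ℚ) → ℚ
sumTo zero    f = 0ℚ
sumTo (suc n) f = sumTo n f ℚ.+ f n

prodTo : ℕ → (ℕ → ℚ) → ℚ
prodTo zero    f = 1ℚ
prodTo (suc n) f = prodTo n f ℚ.* f n

clip : ℤ → ℕ
clip (+ n)    = n
clip -[1+ _ ] = 0

-- ordℕ p m = largest e with p^e ∣ m (for m ≠ 0, p ≥ 2);
-- computed by repeated division, with fuel m (enough since p^e ≤ m).
ordℕ-go : ℕ → ℕ → ℕ → ℕ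
ordℕ-go zero    p m = 0
ordℕ-go (suc f) p zero = 0
ordℕ-go (suc f) p (suc m) with p ℕD.∣? suc m
... | yes (divides q _) = suc (ordℕ-go f p q)
... | no _ = 0

ordℕ : ℕ → ℕ → ℕ
ordℕ p m = ordℕ-go m p m

ordℚ : ℕ → ℚ → ℤ
ordℚ p x = (+ ordℕ p ℤ.∣ ↥ x ∣) ℤ.- (+ ordℕ p (↧ₙ x))

absp : ℕ → ℚ → ℚ
absp p x with x ≟ 0ℚ
... | yes _ = 0ℚ
... | no _  = ppow p (ℤ.- ordℚ p x)

-- membership in ℤ[1/p]: x = m / p^n for some m ∈ ℤ, n ∈ ℕ
-- (equivalently, the reduced denominator of x divides a power of p)
InZ[1/p] : ℕ → ℚ → Set
InZ[1/p] p x = ∃ λ n → (↧ₙ x) ℕD.∣ (p ℕ.^ n)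

-- least c < bound with P c (default 0)
search : ℕ → (ℕ → Bool) → ℕ
search zero    P = 0
search (suc n) P = if P (search n P) then search n P else (if P n then n else 0)

-- For w ∈ ℚ with ord_p(w) ≥ 0: its 0-th p-adic digit is the unique
-- c ∈ {0,…,p-1} with w ≡ c (mod p ℤ_p), i.e. p ∣ (num w - c · den w).
digit0 : ℕ → ℚ → ℕ
digit0 p w = search p (λ c → does (p ℕD.∣? ℤ.∣ (↥ w) ℤ.- (+ c) ℤ.* (+ (↧ₙ w)) ∣))

-- digits p w n = c_n in the expansion w = Σ_{n≥0} c_n p^n  (ord_p w ≥ 0):
-- c_0 = digit0 w, and the remaining digits are those of (w - c_0)/p.
digits : ℕ → ℚ → ℕ → ℕ
digits p w zero    = digit0 p w
digits p w (suc n) = digits p ((w ℚ.- fromℤ (+ digit0 p w)) ℚ.* inv (powℕ p 1)) n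

-- ⟨ξ⟩_k = Σ_{n = ord_p ξ}^{k-1} c_n p^n  where ξ = Σ_{n ≥ ord_p ξ} c_n p^n,
-- and ⟨0⟩_k = 0.  Writing e = ord_p ξ and u = ξ p^{-e} (so ord_p u = 0),
-- c_{e+j} = digits p u j.
trunc : ℕ → ℤ → ℚ → ℚ
trunc p k ξ with ξ ≟ 0ℚ
... | yes _ = 0ℚ
... | no _  = sumTo (clip (k ℤ.- e))
                (λ j → fromℤ (+ digits p u j) ℚ.* ppow p (e ℤ.+ + j))
  where
  e = ordℚ p ξ
  u = ξ ℚ.* ppow p (ℤ.- e)

isZero : ℚ → Bool
isZero x = does (x ≟ 0ℚ)

sylQ : ℕ → ℤ → ℚ → ℚ
sylQ p k ζ = t ℚ.+ fromℤ (ceiling ((1ℚ ℚ.- t ℚ.* ζ) ℚ.* inv (ppow p k ℚ.* ζ))) ℚ.* ppow p k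
  where t = trunc p k (inv ζ)

-- ζ_{i+1} = ζ_i - 1/q_i  (once ζ_i = 0 the procedure has stopped; we stay at 0)
sylStep : ℕ → ℤ → ℚ → ℚ
sylStep p k ζ = if isZero ζ then 0ℚ else ζ ℚ.- inv (sylQ p k ζ)

sylZeta : ℕ → ℤ → ℚ → ℕ → ℚ
sylZeta p k ζ zero    = ζ
sylZeta p k ζ (suc i) = sylStep p k (sylZeta p k ζ i)

sylOut : ℕ → ℤ → ℚ → ℕ → Maybe ℚ
sylOut p k ζ i = if isZero (sylZeta p k ζ i) then nothing else just (sylQ p k (sylZeta p k ζ i))

-- Sequences q, R : ℕ → ℚ with the shift  R i = r_{i-1}  (so R 0 = r_{-1} = a,
-- R (suc i) = r_i).  Step i is performed while r_{i-1} ≠ 0.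

GreedyStep : ℕ → ℤ → ℤ → (q R : ℕ → ℚ) → ℕ → Set
GreedyStep p k b q R i =
    InZ[1/p] p (q i) × InZ[1/p] p (R (suc i))
  × (fromℤ b ℚ.* prodTo i q ≡ R i ℚ.* q i ℚ.- R (suc i))
  × (0ℚ ≤ R (suc i)) × (R (suc i) < R i ℚ.* ppow p k)
  × (absp p (R (suc i)) ≤ absp p (R i ℚ.* ppow p k))

IsGreedyRun : ℕ → ℤ → ℤ → ℤ → (q R : ℕ → ℚ) → Set
IsGreedyRun p k a b q R =
    (R 0 ≡ fromℤ a)
  × (∀ i → ¬ (R i ≡ 0ℚ) → GreedyStep p k b q R i)
  × (∀ i → R i ≡ 0ℚ → R (suc i) ≡ 0ℚ)

greedyOut : (q R : ℕ → ℚ) → ℕ → Maybe ℚ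
greedyOut q R i = if isZero (R i) then nothing else just (q i)

module Submission where

-- Put Bᵢ = b·q₀⋯q_{i-1} and Rᵢ = ζᵢ·Bᵢ (so R₀ = a).  Everything reduces to
-- one division step (DivisionStep): if ζ ≠ 0, R = ζ·B > 0, B, R ∈ ℤ[1/p]
-- and -ord_p ζ < k, then q = sylQ ζ, r = R·q - B is a p^k-division of B by
-- R, it is the only one, and ζ - 1/q = r/(B·q) is again such a state (or 0).
-- Uniqueness: any admissible q has ord_p (q - 1/ζ) = ord_p (r/R) ≥ k, and
-- ord_p (1/ζ - ⟨1/ζ⟩_k) ≥ k, so q = ⟨1/ζ⟩_k + m·p^k with m ∈ ℤ (as q ∈ ℤ[1/p]);
-- the bounds 0 ≤ r < R·p^k then force m = ⌈(1 - tζ)/(p^k ζ)⌉, t = ⟨1/ζ⟩_k.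
-- An induction (Lockstep) shows that every greedy run, and the run built
-- from the Sylvester iterates, agree with procedure (1) at every step.

open import Defs
open import Data.Bool using (Bool; true; false; if_then_else_; T)
open import Data.Maybe using (just; nothing)
open import Data.Nat as ℕ using (ℕ; zero; suc)
import Data.Nat.Properties as ℕP
import Data.Nat.Divisibility as ℕD
import Data.Nat.Coprimality as NC
open import Data.Nat.GCD using (module Bézout)
open import Data.Nat.Primality using (Prime; prime⇒nonZero; prime⇒nonTrivial; prime⇒irreducible; euclidsLemma)
open import Data.Integer as ℤ using (ℤ; +_; -[1+_]; 0ℤ; +[1+_]; +0)
import Data.Integer.Properties as ℤP
import Data.Integer.DivMod as ℤD
import Data.Integer.Divisibility.Signed as ℤS
open import Data.Integer.GCD using (gcd)
open import Data.Integer.Tactic.RingSolver using (solve-∀)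
open import Data.Rational as ℚ using (ℚ; mkℚ; 0ℚ; 1ℚ; ↥_; ↧_; ↧ₙ_; floor; ceiling; *≤*; *<*)
import Data.Rational.Properties as ℚP
open import Data.Rational.Unnormalised as ℚᵘ using (mkℚᵘ)
import Data.Rational.Unnormalised.Properties as ℚᵘP
open import Data.Rational.Solver using (module +-*-Solver)
open +-*-Solver using (solve; _:+_; _:*_; _:-_; :-_; _:=_; con)
open import Data.Empty using (⊥-elim)
open import Data.Sum using (_⊎_; inj₁; inj₂; [_,_]′)
open import Data.Product using (Σ; Σ-syntax; _×_; _,_; proj₁; proj₂)
open import Relation.Nullary using (¬_; Dec; yes; no; does)
open import Relation.Binary.PropositionalEquality

fromℤ-mk : ∀ z → fromℤ z ≡ mkℚ z 0 (NC.sym (NC.1-coprimeTo _))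
fromℤ-mk z = ℚP.↥p/↧p≡p (mkℚ z 0 (NC.sym (NC.1-coprimeTo _)))

↥-fromℤ : ∀ z → ↥ (fromℤ z) ≡ z
↥-fromℤ z = cong ↥_ (fromℤ-mk z)

↧-fromℤ : ∀ z → ↧ₙ (fromℤ z) ≡ 1
↧-fromℤ z = cong ↧ₙ_ (fromℤ-mk z)

fromℤ-injective : ∀ {a b} → fromℤ a ≡ fromℤ b → a ≡ b
fromℤ-injective {a} {b} e = trans (sym (↥-fromℤ a)) (trans (cong ↥_ e) (↥-fromℤ b))

-- the homomorphism laws are transported from the unnormalised rationals
toℚᵘ-fromℤ : ∀ z → ℚ.toℚᵘ (fromℤ z) ≡ mkℚᵘ z 0
toℚᵘ-fromℤ z = cong ℚ.toℚᵘ (fromℤ-mk z)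

fromℤ-* : ∀ a b → fromℤ (a ℤ.* b) ≡ fromℤ a ℚ.* fromℤ b
fromℤ-* a b = ℚP.toℚᵘ-injective (ℚᵘP.≃-trans (ℚᵘP.≃-reflexive (toℚᵘ-fromℤ (a ℤ.* b)))
  (ℚᵘP.≃-sym (ℚᵘP.≃-trans (ℚP.toℚᵘ-homo-* (fromℤ a) (fromℤ b))
    (ℚᵘP.≃-reflexive (cong₂ ℚᵘ._*_ (toℚᵘ-fromℤ a) (toℚᵘ-fromℤ b))))))

fromℤ-+ : ∀ a b → fromℤ (a ℤ.+ b) ≡ fromℤ a ℚ.+ fromℤ b
fromℤ-+ a b = ℚP.toℚᵘ-injective (ℚᵘP.≃-trans (ℚᵘP.≃-reflexive (toℚᵘ-fromℤ (a ℤ.+ b)))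
  (ℚᵘP.≃-trans (ℚᵘ.*≡* (cross a b))
  (ℚᵘP.≃-sym (ℚᵘP.≃-trans (ℚP.toℚᵘ-homo-+ (fromℤ a) (fromℤ b))
    (ℚᵘP.≃-reflexive (cong₂ ℚᵘ._+_ (toℚᵘ-fromℤ a) (toℚᵘ-fromℤ b)))))))
  where
  cross : ∀ a b → (a ℤ.+ b) ℤ.* + 1 ≡ (a ℤ.* + 1 ℤ.+ b ℤ.* + 1) ℤ.* + 1
  cross = solve-∀

fromℤ-neg : ∀ a → fromℤ (ℤ.- a) ≡ ℚ.- fromℤ a
fromℤ-neg a = ℚP.toℚᵘ-injective (ℚᵘP.≃-trans (ℚᵘP.≃-reflexive (toℚᵘ-fromℤ (ℤ.- a)))
  (ℚᵘP.≃-sym (ℚᵘP.≃-trans (ℚP.toℚᵘ-homo‿- (fromℤ a))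
    (ℚᵘP.≃-reflexive (cong ℚᵘ.-_ (toℚᵘ-fromℤ a))))))

fromℤ-- : ∀ a b → fromℤ (a ℤ.- b) ≡ fromℤ a ℚ.- fromℤ b
fromℤ-- a b = trans (fromℤ-+ a (ℤ.- b)) (cong (fromℤ a ℚ.+_) (fromℤ-neg b))

fromℤ-mono-≤ : ∀ {a b} → a ℤ.≤ b → fromℤ a ℚ.≤ fromℤ b
fromℤ-mono-≤ {a} {b} le rewrite fromℤ-mk a | fromℤ-mk b = *≤* (ℤP.*-monoʳ-≤-nonNeg (+ 1) le)

fromℤ-mono-< : ∀ {a b} → a ℤ.< b → fromℤ a ℚ.< fromℤ b
fromℤ-mono-< {a} {b} lt rewrite fromℤ-mk a | fromℤ-mk b =
  *<* (subst₂ ℤ._<_ (sym (ℤP.*-identityʳ a)) (sym (ℤP.*-identityʳ b)) lt)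

fromℤ-cancel-< : ∀ {a b} → fromℤ a ℚ.< fromℤ b → a ℤ.< b
fromℤ-cancel-< {a} {b} lt rewrite fromℤ-mk a | fromℤ-mk b with lt
... | *<* l = subst₂ ℤ._<_ (ℤP.*-identityʳ a) (ℤP.*-identityʳ b) l

*-denominator : ∀ w → w ℚ.* fromℤ (↧ w) ≡ fromℤ (↥ w)
*-denominator w@(mkℚ n d c) = ℚP.toℚᵘ-injective (ℚᵘP.≃-trans (ℚP.toℚᵘ-homo-* w (fromℤ (↧ w)))
  (ℚᵘP.≃-trans (ℚᵘP.≃-reflexive (cong (ℚ.toℚᵘ w ℚᵘ.*_) (toℚᵘ-fromℤ (↧ w))))
  (ℚᵘP.≃-trans (ℚᵘ.*≡* (cross n (+ suc d))) (ℚᵘP.≃-sym (ℚᵘP.≃-reflexive (toℚᵘ-fromℤ n))))))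
  where
  cross : ∀ n D → (n ℤ.* D) ℤ.* + 1 ≡ n ℤ.* (D ℤ.* + 1)
  cross = solve-∀

inv-nonzero : ∀ x (nz : x ≢ 0ℚ) → inv x ≡ (ℚ.1/ x) {{ℚ.≢-nonZero nz}}
inv-nonzero x nz with x ℚP.≟ 0ℚ
... | yes e = ⊥-elim (nz e)
... | no _ = refl

inv-inverseʳ : ∀ x → x ≢ 0ℚ → x ℚ.* inv x ≡ 1ℚ
inv-inverseʳ x nz rewrite inv-nonzero x nz = ℚP.*-inverseʳ x {{ℚ.≢-nonZero nz}}

inv-inverseˡ : ∀ x → x ≢ 0ℚ → inv x ℚ.* x ≡ 1ℚ
inv-inverseˡ x nz = trans (ℚP.*-comm (inv x) x) (inv-inverseʳ x nz)

inv≢0 : ∀ x → x ≢ 0ℚ → inv x ≢ 0ℚ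
inv≢0 x nz e = ℚP.1≢0 (trans (sym (inv-inverseʳ x nz)) (trans (cong (x ℚ.*_) e) (ℚP.*-zeroʳ x)))

*-inv-cancel : ∀ x y → x ≢ 0ℚ → (x ℚ.* y) ℚ.* inv x ≡ y
*-inv-cancel x y nz = trans (solve 3 (λ x y i → (x :* y) :* i := y :* (x :* i)) refl x y (inv x))
  (trans (cong (y ℚ.*_) (inv-inverseʳ x nz)) (ℚP.*-identityʳ y))

*≢0 : ∀ x y → x ≢ 0ℚ → y ≢ 0ℚ → x ℚ.* y ≢ 0ℚ
*≢0 x y nx ny e = ny (trans (sym (trans (ℚP.*-comm (x ℚ.* y) (inv x)) (*-inv-cancel' x y nx)))
                       (trans (cong (ℚ._* inv x) e) (ℚP.*-zeroˡ (inv x))))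
  where
  *-inv-cancel' : ∀ x y → x ≢ 0ℚ → inv x ℚ.* (x ℚ.* y) ≡ y
  *-inv-cancel' x y nz = trans (ℚP.*-comm (inv x) (x ℚ.* y)) (*-inv-cancel x y nz)

inv-unique : ∀ x y → x ℚ.* y ≡ 1ℚ → inv x ≡ y
inv-unique x y e = begin
  inv x                ≡⟨ sym (ℚP.*-identityʳ (inv x)) ⟩
  inv x ℚ.* 1ℚ         ≡⟨ cong (inv x ℚ.*_) (sym e) ⟩
  inv x ℚ.* (x ℚ.* y)  ≡⟨ sym (ℚP.*-assoc (inv x) x y) ⟩
  (inv x ℚ.* x) ℚ.* y  ≡⟨ cong (ℚ._* y) (inv-inverseˡ x x≢0) ⟩
  1ℚ ℚ.* y             ≡⟨ ℚP.*-identityˡ y ⟩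
  y                    ∎
  where
  open ≡-Reasoning
  x≢0 : x ≢ 0ℚ
  x≢0 x0 = ℚP.1≢0 (trans (sym e) (trans (cong (ℚ._* y) x0) (ℚP.*-zeroˡ y)))

inv-* : ∀ x y → x ≢ 0ℚ → y ≢ 0ℚ → inv (x ℚ.* y) ≡ inv x ℚ.* inv y
inv-* x y nx ny = inv-unique (x ℚ.* y) (inv x ℚ.* inv y) (begin
  (x ℚ.* y) ℚ.* (inv x ℚ.* inv y)  ≡⟨ solve 4 (λ x y a b → (x :* y) :* (a :* b) := (x :* a) :* (y :* b)) refl x y (inv x) (inv y) ⟩
  (x ℚ.* inv x) ℚ.* (y ℚ.* inv y)  ≡⟨ cong₂ ℚ._*_ (inv-inverseʳ x nx) (inv-inverseʳ y ny) ⟩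
  1ℚ                               ∎)
  where open ≡-Reasoning

pos⇒≢0 : ∀ {x} → 0ℚ ℚ.< x → x ≢ 0ℚ
pos⇒≢0 lt e = ℚP.<-irrefl (sym e) lt

nonNeg∧≢0⇒pos : ∀ {r} → 0ℚ ℚ.≤ r → r ≢ 0ℚ → 0ℚ ℚ.< r
nonNeg∧≢0⇒pos {r} le nz with 0ℚ ℚP.<? r
... | yes lt = lt
... | no nlt = ⊥-elim (nz (ℚP.≤-antisym (ℚP.≮⇒≥ nlt) le))

inv-pos : ∀ x → 0ℚ ℚ.< x → 0ℚ ℚ.< inv x
inv-pos x lt rewrite inv-nonzero x (pos⇒≢0 lt) =
  ℚP.positive⁻¹ _ {{ℚP.1/pos⇒pos x {{ℚ.positive lt}}}}

*-pos : ∀ x y → 0ℚ ℚ.< x → 0ℚ ℚ.< y → 0ℚ ℚ.< x ℚ.* y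
*-pos x y lx ly = ℚP.positive⁻¹ _ {{ℚP.pos*pos⇒pos x {{ℚ.positive lx}} y {{ℚ.positive ly}}}}

≤⇒0≤- : ∀ a b → a ℚ.≤ b → 0ℚ ℚ.≤ b ℚ.- a
≤⇒0≤- a b le = subst₂ ℚ._≤_ (ℚP.+-inverseʳ a) refl (ℚP.+-monoˡ-≤ (ℚ.- a) le)

0≤-⇒≤ : ∀ a b → 0ℚ ℚ.≤ b ℚ.- a → a ℚ.≤ b
0≤-⇒≤ a b le = subst₂ ℚ._≤_ (ℚP.+-identityˡ a) (solve 2 (λ a b → (b :- a) :+ a := b) refl a b) (ℚP.+-monoˡ-≤ a le)

<+1⇒-<1 : ∀ a b → b ℚ.< a ℚ.+ 1ℚ → b ℚ.- a ℚ.< 1ℚ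
<+1⇒-<1 a b lt = subst₂ ℚ._<_ refl (solve 1 (λ a → (a :+ con 1ℚ) :- a := con 1ℚ) refl a) (ℚP.+-monoˡ-< (ℚ.- a) lt)

-<1⇒<+1 : ∀ a b → b ℚ.- a ℚ.< 1ℚ → b ℚ.< a ℚ.+ 1ℚ
-<1⇒<+1 a b lt = subst₂ ℚ._<_ (solve 2 (λ a b → (b :- a) :+ a := b) refl a b) (ℚP.+-comm 1ℚ a) (ℚP.+-monoˡ-< a lt)

floor-spec : ∀ y → (fromℤ (floor y) ℚ.≤ y) × (y ℚ.< fromℤ (floor y ℤ.+ + 1))
floor-spec y@(mkℚ n d c) = below , above
  where
  f : ℤ
  f = n ℤD./ (+ suc d)
  r : ℕ
  r = n ℤD.% (+ suc d)
  n≡r+fd : n ≡ + r ℤ.+ f ℤ.* + suc d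
  n≡r+fd = ℤD.a≡a%n+[a/n]*n n (+ suc d)
  below : fromℤ f ℚ.≤ y
  below rewrite fromℤ-mk f = *≤* (subst₂ ℤ._≤_ refl (sym (ℤP.*-identityʳ n))
    (subst (f ℤ.* + suc d ℤ.≤_) (sym n≡r+fd) (ℤP.i≤j+i (f ℤ.* + suc d) (+ r))))
  above : y ℚ.< fromℤ (f ℤ.+ + 1)
  above rewrite fromℤ-mk (f ℤ.+ + 1) = *<* (subst₂ ℤ._<_ (sym (ℤP.*-identityʳ n)) (sym (distrib f (+ suc d)))
    (subst (ℤ._< f ℤ.* + suc d ℤ.+ + suc d) (sym n≡r+fd)
      (subst (ℤ._< f ℤ.* + suc d ℤ.+ + suc d) (ℤP.+-comm (f ℤ.* + suc d) (+ r))
        (ℤP.+-monoʳ-< (f ℤ.* + suc d) (ℤ.+<+ (ℤD.n%d<d n (+ suc d)))))))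
    where
    distrib : ∀ f D → (f ℤ.+ + 1) ℤ.* D ≡ f ℤ.* D ℤ.+ D
    distrib = solve-∀

-- ⌈x⌉ = -⌊-x⌋, so x ≤ ⌈x⌉ < x + 1
ceiling-spec : ∀ x → (x ℚ.≤ fromℤ (ceiling x)) × (fromℤ (ceiling x) ℚ.< x ℚ.+ 1ℚ)
ceiling-spec x@(mkℚ n d c) = below , above
  where
  f : ℤ
  f = floor (ℚ.- x)
  fs : (fromℤ f ℚ.≤ ℚ.- x) × (ℚ.- x ℚ.< fromℤ (f ℤ.+ + 1))
  fs = floor-spec (ℚ.- x)
  negneg : ℚ.- (ℚ.- x) ≡ x
  negneg = solve 1 (λ x → :- (:- x) := x) refl x
  below : x ℚ.≤ fromℤ (ℤ.- f)
  below = subst₂ ℚ._≤_ negneg (sym (fromℤ-neg f)) (ℚP.neg-antimono-≤ (proj₁ fs))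
  step : fromℤ (ℤ.- (f ℤ.+ + 1)) ℚ.< x
  step = subst₂ ℚ._<_ (sym (fromℤ-neg (f ℤ.+ + 1))) negneg (ℚP.neg-antimono-< (proj₂ fs))
  shift : ∀ f → ℤ.- (f ℤ.+ + 1) ℤ.+ + 1 ≡ ℤ.- f
  shift = solve-∀
  above : fromℤ (ℤ.- f) ℚ.< x ℚ.+ 1ℚ
  above = subst (ℚ._< x ℚ.+ 1ℚ) (trans (sym (fromℤ-+ (ℤ.- (f ℤ.+ + 1)) (+ 1))) (cong fromℤ (shift f)))
                (ℚP.+-monoˡ-< 1ℚ step)

ceiling-unique : ∀ x m → x ℚ.≤ fromℤ m → fromℤ m ℚ.< x ℚ.+ 1ℚ → ceiling x ≡ m
ceiling-unique x m le lt =
  ℤP.≤-antisym (squeeze (ceiling x) m (proj₂ (ceiling-spec x)) le) (squeeze m (ceiling x) lt (proj₁ (ceiling-spec x)))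
  where
  squeeze : ∀ a b → fromℤ a ℚ.< x ℚ.+ 1ℚ → x ℚ.≤ fromℤ b → a ℤ.≤ b
  squeeze a b a<x+1 x≤b = subst (a ℤ.≤_) (pred-suc b) (ℤP.i<j⇒i≤pred[j] (fromℤ-cancel-< {a} {b ℤ.+ + 1} (ℚP.<-≤-trans a<x+1 x+1≤b+1)))
    where
    pred-suc : ∀ b → ℤ.- (+ 1) ℤ.+ (b ℤ.+ + 1) ≡ b
    pred-suc = solve-∀
    x+1≤b+1 : x ℚ.+ 1ℚ ℚ.≤ fromℤ (b ℤ.+ + 1)
    x+1≤b+1 = subst (x ℚ.+ 1ℚ ℚ.≤_) (sym (fromℤ-+ b (+ 1))) (ℚP.+-monoˡ-≤ 1ℚ x≤b)

sumTo-cong : ∀ n f g → (∀ j → f j ≡ g j) → sumTo n f ≡ sumTo n g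
sumTo-cong zero f g e = refl
sumTo-cong (suc n) f g e = cong₂ ℚ._+_ (sumTo-cong n f g e) (e n)

sumTo-suc : ∀ n f → sumTo (suc n) f ≡ f 0 ℚ.+ sumTo n (λ j → f (suc j))
sumTo-suc zero f = trans (ℚP.+-identityˡ (f 0)) (sym (ℚP.+-identityʳ (f 0)))
sumTo-suc (suc n) f = trans (cong (ℚ._+ f (suc n)) (sumTo-suc n f)) (ℚP.+-assoc (f 0) _ _)

sumTo-*ˡ : ∀ n a f → sumTo n (λ j → a ℚ.* f j) ≡ a ℚ.* sumTo n f
sumTo-*ˡ zero a f = sym (ℚP.*-zeroʳ a)
sumTo-*ˡ (suc n) a f = trans (cong (ℚ._+ (a ℚ.* f n)) (sumTo-*ˡ n a f)) (sym (ℚP.*-distribˡ-+ a (sumTo n f) (f n)))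

search-finds : ∀ n (P : ℕ → Bool) c → c ℕ.< n → T (P c) → T (P (search n P))
search-finds (suc n) P c c<1+n Pc with P (search n P) in found
... | true = subst T (sym found) _
... | false with P n in last
...   | true = subst T (sym last) _
...   | false with ℕP.m≤n⇒m<n∨m≡n (ℕP.≤-pred c<1+n)
...     | inj₁ c<n = ⊥-elim (subst T found (search-finds n P c c<n Pc))
...     | inj₂ refl = ⊥-elim (subst T last Pc)

search-witness : ∀ {Q : ℕ → Set} (Q? : ∀ c → Dec (Q c)) n c → c ℕ.< n → Q c → Q (search n (λ c → does (Q? c)))
search-witness Q? n c c<n Qc = witness (Q? _) (search-finds n (λ c → does (Q? c)) c c<n (reflect (Q? c) Qc))
  where
  reflect : ∀ {A : Set} (A? : Dec A) → A → T (does A?)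
  reflect (yes _) _ = _
  reflect (no ¬a) a = ¬a a
  witness : ∀ {A : Set} (A? : Dec A) → T (does A?) → A
  witness (yes a) _ = a

module PAdic (p : ℕ) (pr : Prime p) where

  instance
    p≢0 : ℕ.NonZero p
    p≢0 = prime⇒nonZero pr

  p≥2 : 2 ℕ.≤ p
  p≥2 = ℕ.nonTrivial⇒n>1 p {{prime⇒nonTrivial pr}}

  ord : ℕ → ℕ
  ord m = ordℕ p m

  ordℕ-go-dvd : ∀ f m → p ℕ.^ ordℕ-go f p m ℕD.∣ m
  ordℕ-go-dvd zero m = ℕD.1∣ m
  ordℕ-go-dvd (suc f) zero = ℕD.1∣ 0
  ordℕ-go-dvd (suc f) (suc m) with p ℕD.∣? suc m
  ... | yes (ℕD.divides q eq) = subst (λ z → p ℕ.* p ℕ.^ ordℕ-go f p q ℕD.∣ z) (trans (ℕP.*-comm p q) (sym eq))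
                                      (ℕD.*-monoʳ-∣ p (ordℕ-go-dvd f q))
  ... | no _ = ℕD.1∣ _

  ordℕ-go-maximal : ∀ f m → m ≢ 0 → m ℕ.≤ f → ¬ (p ℕ.^ suc (ordℕ-go f p m) ℕD.∣ m)
  ordℕ-go-maximal f zero m≢0 _ _ = m≢0 refl
  ordℕ-go-maximal zero (suc m) _ () _
  ordℕ-go-maximal (suc f) (suc m) _ (ℕ.s≤s m≤f) d with p ℕD.∣? suc m
  ... | no ¬d = ¬d (subst (ℕD._∣ suc m) (ℕP.*-identityʳ p) d)
  ... | yes (ℕD.divides q eq) = ordℕ-go-maximal f q q≢0 (ℕP.≤-trans q≤m m≤f) d'
    where
    q≢0 : q ≢ 0
    q≢0 refl = ℕP.1+n≢0 eq
    -- the cofactor q = (m+1)/p is at most m since p ≥ 2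
    q≤m : q ℕ.≤ m
    q≤m = ℕP.≤-pred (ℕP.<-≤-trans (ℕP.m<m*n q p (ℕP.≤-trans (ℕ.s≤s (ℕ.s≤s ℕ.z≤n)) p≥2))
                                  (ℕP.≤-reflexive (sym eq)))
      where
      instance
        q-nonZero : ℕ.NonZero q
        q-nonZero = ℕ.≢-nonZero q≢0
    d' : p ℕ.^ suc (ordℕ-go f p q) ℕD.∣ q
    d' = ℕD.*-cancelˡ-∣ p (subst (λ z → p ℕ.* p ℕ.^ suc (ordℕ-go f p q) ℕD.∣ z) (trans eq (ℕP.*-comm q p)) d)

  ord-dvd : ∀ m → p ℕ.^ ord m ℕD.∣ m
  ord-dvd m = ordℕ-go-dvd m m

  ord-maximal : ∀ m → m ≢ 0 → ¬ (p ℕ.^ suc (ord m) ℕD.∣ m)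
  ord-maximal m m≢0 = ordℕ-go-maximal m m m≢0 ℕP.≤-refl

  ^-mono-∣ : ∀ a b → a ℕ.≤ b → p ℕ.^ a ℕD.∣ p ℕ.^ b
  ^-mono-∣ a b a≤b = ℕD.divides (p ℕ.^ (b ℕ.∸ a))
    (trans (cong (p ℕ.^_) (sym (ℕP.m∸n+n≡m a≤b))) (ℕP.^-distribˡ-+-* p (b ℕ.∸ a) a))

  dvd⇒≤ord : ∀ m e → m ≢ 0 → p ℕ.^ e ℕD.∣ m → e ℕ.≤ ord m
  dvd⇒≤ord m e m≢0 d with e ℕ.≤? ord m
  ... | yes le = le
  ... | no nle = ⊥-elim (ord-maximal m m≢0 (ℕD.∣-trans (^-mono-∣ (suc (ord m)) e (ℕP.≰⇒> nle)) d))

  ¬dvd⇒ord≤ : ∀ m e → ¬ (p ℕ.^ suc e ℕD.∣ m) → ord m ℕ.≤ e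
  ¬dvd⇒ord≤ m e nd with ord m ℕ.≤? e
  ... | yes le = le
  ... | no nle = ⊥-elim (nd (ℕD.∣-trans (^-mono-∣ (suc e) (ord m) (ℕP.≰⇒> nle)) (ord-dvd m)))

  -- ord is additive; the upper bound is Euclid's lemma for p
  ord-* : ∀ m n → m ≢ 0 → n ≢ 0 → ord (m ℕ.* n) ≡ ord m ℕ.+ ord n
  ord-* m n m≢0 n≢0 = ℕP.≤-antisym (¬dvd⇒ord≤ (m ℕ.* n) (a ℕ.+ b) no-higher-power) lower
    where
    a b : ℕ
    a = ord m
    b = ord n
    lower : a ℕ.+ b ℕ.≤ ord (m ℕ.* n)
    lower = dvd⇒≤ord (m ℕ.* n) (a ℕ.+ b) (λ e → [ m≢0 , n≢0 ]′ (ℕP.m*n≡0⇒m≡0∨n≡0 m e))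
              (subst (ℕD._∣ m ℕ.* n) (sym (ℕP.^-distribˡ-+-* p a b)) (ℕD.*-pres-∣ (ord-dvd m) (ord-dvd n)))
    m' n' : ℕ
    m' = ℕD.quotient (ord-dvd m)
    n' = ℕD.quotient (ord-dvd n)
    m≡ : m ≡ p ℕ.^ a ℕ.* m'
    m≡ = ℕD.m∣n⇒n≡m*quotient (ord-dvd m)
    n≡ : n ≡ p ℕ.^ b ℕ.* n'
    n≡ = ℕD.m∣n⇒n≡m*quotient (ord-dvd n)
    p∤m' : ¬ (p ℕD.∣ m')
    p∤m' d = ord-maximal m m≢0 (subst (p ℕ.^ suc a ℕD.∣_) (sym m≡)
               (subst (ℕD._∣ p ℕ.^ a ℕ.* m') (ℕP.*-comm (p ℕ.^ a) p) (ℕD.*-monoʳ-∣ (p ℕ.^ a) d)))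
    p∤n' : ¬ (p ℕD.∣ n')
    p∤n' d = ord-maximal n n≢0 (subst (p ℕ.^ suc b ℕD.∣_) (sym n≡)
               (subst (ℕD._∣ p ℕ.^ b ℕ.* n') (ℕP.*-comm (p ℕ.^ b) p) (ℕD.*-monoʳ-∣ (p ℕ.^ b) d)))
    instance
      pᵃ⁺ᵇ≢0 : ℕ.NonZero (p ℕ.^ (a ℕ.+ b))
      pᵃ⁺ᵇ≢0 = ℕP.m^n≢0 p (a ℕ.+ b)
    mn≡ : m ℕ.* n ≡ p ℕ.^ (a ℕ.+ b) ℕ.* (m' ℕ.* n')
    mn≡ = begin
      m ℕ.* n                               ≡⟨ cong₂ ℕ._*_ m≡ n≡ ⟩
      (p ℕ.^ a ℕ.* m') ℕ.* (p ℕ.^ b ℕ.* n') ≡⟨ ℕP.[m*n]*[o*p]≡[m*o]*[n*p] (p ℕ.^ a) m' (p ℕ.^ b) n' ⟩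
      (p ℕ.^ a ℕ.* p ℕ.^ b) ℕ.* (m' ℕ.* n') ≡⟨ cong (ℕ._* (m' ℕ.* n')) (sym (ℕP.^-distribˡ-+-* p a b)) ⟩
      p ℕ.^ (a ℕ.+ b) ℕ.* (m' ℕ.* n')       ∎
      where open ≡-Reasoning
    no-higher-power : ¬ (p ℕ.^ suc (a ℕ.+ b) ℕD.∣ m ℕ.* n)
    no-higher-power d = [ p∤m' , p∤n' ]′ (euclidsLemma m' n' pr
      (ℕD.*-cancelˡ-∣ (p ℕ.^ (a ℕ.+ b))
        (subst₂ ℕD._∣_ (ℕP.*-comm p (p ℕ.^ (a ℕ.+ b))) mn≡ d)))

  ord-1 : ord 1 ≡ 0
  ord-1 = ℕP.n≤0⇒n≡0 (¬dvd⇒ord≤ 1 0 (λ d → ℕP.<⇒≱ (ℕP.≤-trans p≥2 (ℕP.≤-reflexive (sym (ℕP.*-identityʳ p)))) (ℕD.∣⇒≤ d)))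

  ord-p : ord p ≡ 1
  ord-p = ℕP.≤-antisym (¬dvd⇒ord≤ p 1 p²∤p) (dvd⇒≤ord p 1 (ℕ.≢-nonZero⁻¹ p) (subst (ℕD._∣ p) (sym (ℕP.*-identityʳ p)) ℕD.∣-refl))
    where
    p<p² : p ℕ.< p ℕ.^ 2
    p<p² = ℕP.<-≤-trans (subst (ℕ._< p ℕ.* p) (ℕP.*-identityʳ p) (ℕP.*-monoʳ-< p (ℕP.≤-trans (ℕ.s≤s (ℕ.s≤s ℕ.z≤n)) p≥2)))
                        (ℕP.≤-reflexive (cong (p ℕ.*_) (sym (ℕP.*-identityʳ p))))
    p²∤p : ¬ (p ℕ.^ 2 ℕD.∣ p)
    p²∤p d = ℕP.<⇒≱ p<p² (ℕD.∣⇒≤ d)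

  ord-^ : ∀ e → ord (p ℕ.^ e) ≡ e
  ord-^ zero = ord-1
  ord-^ (suc e) = trans (ord-* p (p ℕ.^ e) (ℕ.≢-nonZero⁻¹ p) (ℕ.≢-nonZero⁻¹ (p ℕ.^ e) {{ℕP.m^n≢0 p e}}))
                        (cong₂ ℕ._+_ ord-p (ord-^ e))

  p∤⇒ord≡0 : ∀ d → ¬ (p ℕD.∣ d) → ord d ≡ 0
  p∤⇒ord≡0 d p∤d = ℕP.n≤0⇒n≡0 (¬dvd⇒ord≤ d 0 (λ x → p∤d (subst (ℕD._∣ d) (ℕP.*-identityʳ p) x)))

  p∤⇒coprime : ∀ d → ¬ (p ℕD.∣ d) → NC.Coprime d p
  p∤⇒coprime d p∤d (i∣d , i∣p) with prime⇒irreducible pr i∣p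
  ... | inj₁ e = e
  ... | inj₂ refl = ⊥-elim (p∤d i∣d)

  p∤∧∣pᵃ⇒≡1 : ∀ d a → ¬ (p ℕD.∣ d) → d ℕD.∣ p ℕ.^ a → d ≡ 1
  p∤∧∣pᵃ⇒≡1 d zero _ dv = ℕD.∣1⇒≡1 dv
  p∤∧∣pᵃ⇒≡1 d (suc a) p∤d dv = p∤∧∣pᵃ⇒≡1 d a p∤d (NC.coprime-divisor (p∤⇒coprime d p∤d) dv)

  -- Valuation on ℤ.  DivPow M z says p^M ∣ z, phrased through ord so that
  -- it makes sense for every integer exponent M (vacuous for M ≤ 0).

  ordℤ : ℤ → ℕ
  ordℤ z = ord ℤ.∣ z ∣

  DivPow : ℤ → ℤ → Set
  DivPow M z = z ≡ 0ℤ ⊎ M ℤ.≤ + ordℤ z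

  ∣z∣≢0 : ∀ z → z ≢ 0ℤ → ℤ.∣ z ∣ ≢ 0
  ∣z∣≢0 z z≢0 e = z≢0 (ℤP.∣i∣≡0⇒i≡0 e)

  ordℤ-* : ∀ z₁ z₂ → z₁ ≢ 0ℤ → z₂ ≢ 0ℤ → ordℤ (z₁ ℤ.* z₂) ≡ ordℤ z₁ ℕ.+ ordℤ z₂
  ordℤ-* z₁ z₂ n₁ n₂ = trans (cong ord (ℤP.abs-* z₁ z₂)) (ord-* _ _ (∣z∣≢0 z₁ n₁) (∣z∣≢0 z₂ n₂))

  DivPow-nonPos : ∀ M z → M ℤ.≤ 0ℤ → DivPow M z
  DivPow-nonPos M z le = inj₂ (ℤP.≤-trans le (ℤ.+≤+ ℕ.z≤n))

  DivPow⇒∣ : ∀ m z → DivPow (+ m) z → p ℕ.^ m ℕD.∣ ℤ.∣ z ∣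
  DivPow⇒∣ m z (inj₁ refl) = ℕD._∣0 _
  DivPow⇒∣ m z (inj₂ (ℤ.+≤+ le)) = ℕD.∣-trans (^-mono-∣ m (ordℤ z) le) (ord-dvd _)

  ∣⇒DivPow : ∀ m z → p ℕ.^ m ℕD.∣ ℤ.∣ z ∣ → DivPow (+ m) z
  ∣⇒DivPow m z d with z ℤP.≟ 0ℤ
  ... | yes e = inj₁ e
  ... | no z≢0 = inj₂ (ℤ.+≤+ (dvd⇒≤ord _ m (∣z∣≢0 z z≢0) d))

  DivPow-+ : ∀ M z₁ z₂ → DivPow M z₁ → DivPow M z₂ → DivPow M (z₁ ℤ.+ z₂)
  DivPow-+ -[1+ m ] z₁ z₂ _ _ = DivPow-nonPos _ _ ℤ.-≤+
  DivPow-+ (+ m) z₁ z₂ d₁ d₂ = ∣⇒DivPow m _ (ℤS.∣⇒∣ᵤ {+ (p ℕ.^ m)} {z₁ ℤ.+ z₂}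
    (ℤS.∣m∣n⇒∣m+n (ℤS.∣ᵤ⇒∣ {+ (p ℕ.^ m)} {z₁} (DivPow⇒∣ m z₁ d₁)) (ℤS.∣ᵤ⇒∣ {+ (p ℕ.^ m)} {z₂} (DivPow⇒∣ m z₂ d₂))))

  DivPow-neg : ∀ M z → DivPow M z → DivPow M (ℤ.- z)
  DivPow-neg M z (inj₁ refl) = inj₁ refl
  DivPow-neg M z (inj₂ l) = inj₂ (subst (λ u → M ℤ.≤ + ord u) (sym (ℤP.∣-i∣≡∣i∣ z)) l)

  DivPow-* : ∀ a b z₁ z₂ → DivPow a z₁ → DivPow b z₂ → DivPow (a ℤ.+ b) (z₁ ℤ.* z₂)
  DivPow-* a b z₁ z₂ (inj₁ refl) _ = inj₁ refl
  DivPow-* a b z₁ z₂ (inj₂ _) (inj₁ refl) = inj₁ (ℤP.*-zeroʳ z₁)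
  DivPow-* a b z₁ z₂ (inj₂ l₁) (inj₂ l₂) with z₁ ℤP.≟ 0ℤ | z₂ ℤP.≟ 0ℤ
  ... | yes refl | _ = inj₁ refl
  ... | no _ | yes refl = inj₁ (ℤP.*-zeroʳ z₁)
  ... | no n₁ | no n₂ = inj₂ (subst (λ u → a ℤ.+ b ℤ.≤ + u) (sym (ordℤ-* z₁ z₂ n₁ n₂)) (ℤP.+-mono-≤ l₁ l₂))

  -- Valuation on ℚ.  Ord≥ k x says ord_p x ≥ k (with ord_p 0 = ∞), i.e.
  -- x ∈ p^k ℤ_(p).  We compute it on any fraction n/d representing x.

  Ord≥ : ℤ → ℚ → Set
  Ord≥ k x = x ≡ 0ℚ ⊎ k ℤ.≤ ordℚ p x

  Ord≥-refl : ∀ x → Ord≥ (ordℚ p x) x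
  Ord≥-refl x = inj₂ ℤP.≤-refl

  Ord≥-mono : ∀ {k k' x} → k' ℤ.≤ k → Ord≥ k x → Ord≥ k' x
  Ord≥-mono le (inj₁ e) = inj₁ e
  Ord≥-mono le (inj₂ l) = inj₂ (ℤP.≤-trans le l)

  -- x = n / d  (d ≠ 0), not necessarily in lowest terms
  record Represents (x : ℚ) (n : ℤ) (d : ℕ) : Set where
    constructor _,_
    field
      denominator≢0 : d ≢ 0
      cross-multiply : ↥ x ℤ.* + d ≡ n ℤ.* ↧ x

  represents-self : ∀ x → Represents x (↥ x) (↧ₙ x)
  represents-self (mkℚ n d c) = (λ ()) , refl

  ↧≢0 : ∀ x → ↧ x ≢ 0ℤ
  ↧≢0 (mkℚ n d c) ()

  ↥≢0 : ∀ x → x ≢ 0ℚ → ↥ x ≢ 0ℤ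
  ↥≢0 x x≢0 e = x≢0 (ℚP.↥p≡0⇒p≡0 x e)

  represents-0⇒ : ∀ {x n d} → Represents x n d → n ≡ 0ℤ → x ≡ 0ℚ
  represents-0⇒ {x} (d≢0 , eq) refl = ℚP.↥p≡0⇒p≡0 x
    ([ (λ z → z) , (λ z → ⊥-elim (d≢0 (ℤP.+-injective z))) ]′ (ℤP.i*j≡0⇒i≡0∨j≡0 (↥ x) eq))

  represents-⇒0 : ∀ {x n d} → Represents x n d → x ≡ 0ℚ → n ≡ 0ℤ
  represents-⇒0 {x} {n} (_ , eq) refl = [ (λ z → z) , (λ z → ⊥-elim (↧≢0 0ℚ z)) ]′ (ℤP.i*j≡0⇒i≡0∨j≡0 n (sym eq))

  +≤⇒≤- : ∀ (a b c : ℤ) → a ℤ.+ b ℤ.≤ c → a ℤ.≤ c ℤ.- b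
  +≤⇒≤- a b c le = subst (ℤ._≤ c ℤ.- b) (cancel a b) (ℤP.+-monoˡ-≤ (ℤ.- b) le)
    where
    cancel : ∀ a b → a ℤ.+ b ℤ.- b ≡ a
    cancel = solve-∀

  ≤-⇒+≤ : ∀ (a b c : ℤ) → a ℤ.≤ c ℤ.- b → a ℤ.+ b ℤ.≤ c
  ≤-⇒+≤ a b c le = subst (a ℤ.+ b ℤ.≤_) (cancel c b) (ℤP.+-monoˡ-≤ b le)
    where
    cancel : ∀ c b → c ℤ.- b ℤ.+ b ≡ c
    cancel = solve-∀

  represents-ord : ∀ {x n d} → Represents x n d → n ≢ 0ℤ → ordℚ p x ≡ + ordℤ n ℤ.- + ord d
  represents-ord {x} {n} {d} r@(d≢0 , eq) n≢0 =
    exchange (+ ordℤ (↥ x)) (+ ord (↧ₙ x)) (+ ordℤ n) (+ ord d) (cong +_ cross-ord)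
    where
    x≢0 : x ≢ 0ℚ
    x≢0 e = n≢0 (represents-⇒0 r e)
    cross-ord : ordℤ (↥ x) ℕ.+ ord d ≡ ordℤ n ℕ.+ ord (↧ₙ x)
    cross-ord = trans (sym (ordℤ-* (↥ x) (+ d) (↥≢0 x x≢0) (λ e → d≢0 (ℤP.+-injective e))))
                (trans (cong (λ z → ord ℤ.∣ z ∣) eq) (ordℤ-* n (↧ x) n≢0 (↧≢0 x)))
    exchange : ∀ (a b c d : ℤ) → a ℤ.+ d ≡ c ℤ.+ b → a ℤ.- b ≡ c ℤ.- d
    exchange a b c d eq = begin
      a ℤ.- b                 ≡⟨ add-both a b d ⟩
      (a ℤ.+ d) ℤ.- (b ℤ.+ d) ≡⟨ cong (ℤ._- (b ℤ.+ d)) eq ⟩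
      (c ℤ.+ b) ℤ.- (b ℤ.+ d) ≡⟨ cancel c b d ⟩
      c ℤ.- d                 ∎
      where
      open ≡-Reasoning
      add-both : ∀ a b d → a ℤ.- b ≡ (a ℤ.+ d) ℤ.- (b ℤ.+ d)
      add-both = solve-∀
      cancel : ∀ c b d → (c ℤ.+ b) ℤ.- (b ℤ.+ d) ≡ c ℤ.- d
      cancel = solve-∀

  DivPow⇒Ord≥ : ∀ {x n d} k → Represents x n d → DivPow (k ℤ.+ + ord d) n → Ord≥ k x
  DivPow⇒Ord≥ k r (inj₁ e) = inj₁ (represents-0⇒ r e)
  DivPow⇒Ord≥ {x} {n} {d} k r (inj₂ le) with n ℤP.≟ 0ℤ
  ... | yes e = inj₁ (represents-0⇒ r e)
  ... | no n≢0 = inj₂ (subst (k ℤ.≤_) (sym (represents-ord r n≢0)) (+≤⇒≤- k (+ ord d) (+ ordℤ n) le))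

  Ord≥⇒DivPow : ∀ {x n d} k → Represents x n d → Ord≥ k x → DivPow (k ℤ.+ + ord d) n
  Ord≥⇒DivPow k r (inj₁ e) = inj₁ (represents-⇒0 r e)
  Ord≥⇒DivPow {x} {n} {d} k r (inj₂ le) with n ℤP.≟ 0ℤ
  ... | yes e = inj₁ e
  ... | no n≢0 = inj₂ (≤-⇒+≤ k (+ ord d) (+ ordℤ n) (subst (k ℤ.≤_) (represents-ord r n≢0) le))

  represents-* : ∀ x y → Represents (x ℚ.* y) (↥ x ℤ.* ↥ y) (↧ₙ x ℕ.* ↧ₙ y)
  represents-* x@(mkℚ _ _ _) y@(mkℚ _ _ _) = (λ ()) ,
    subst₂ (λ u v → u ℤ.* + (↧ₙ x ℕ.* ↧ₙ y) ≡ (↥ x ℤ.* ↥ y) ℤ.* v)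
           (ℚP.↥ᵘ-toℚᵘ (x ℚ.* y)) (ℚP.↧ᵘ-toℚᵘ (x ℚ.* y)) (ℚᵘP.drop-*≡* (ℚP.toℚᵘ-homo-* x y))

  represents-+ : ∀ x y → Represents (x ℚ.+ y) (↥ x ℤ.* ↧ y ℤ.+ ↥ y ℤ.* ↧ x) (↧ₙ x ℕ.* ↧ₙ y)
  represents-+ x@(mkℚ _ _ _) y@(mkℚ _ _ _) = (λ ()) ,
    subst₂ (λ u v → u ℤ.* + (↧ₙ x ℕ.* ↧ₙ y) ≡ (↥ x ℤ.* ↧ y ℤ.+ ↥ y ℤ.* ↧ x) ℤ.* v)
           (ℚP.↥ᵘ-toℚᵘ (x ℚ.+ y)) (ℚP.↧ᵘ-toℚᵘ (x ℚ.+ y)) (ℚᵘP.drop-*≡* (ℚP.toℚᵘ-homo-+ x y))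

  represents-neg : ∀ x → Represents (ℚ.- x) (ℤ.- ↥ x) (↧ₙ x)
  represents-neg (mkℚ -[1+ n ] d c) = (λ ()) , refl
  represents-neg (mkℚ +0 d c) = (λ ()) , refl
  represents-neg (mkℚ +[1+ n ] d c) = (λ ()) , refl

  represents-fromℤ : ∀ z → Represents (fromℤ z) z 1
  represents-fromℤ z rewrite fromℤ-mk z = (λ ()) , refl

  ↧ₙ≢0 : ∀ x → ↧ₙ x ≢ 0
  ↧ₙ≢0 (mkℚ _ _ _) ()

  ord↧-* : ∀ x y → + ord (↧ₙ x ℕ.* ↧ₙ y) ≡ + ord (↧ₙ x) ℤ.+ + ord (↧ₙ y)
  ord↧-* x y = cong +_ (ord-* _ _ (↧ₙ≢0 x) (↧ₙ≢0 y))

  Ord≥-neg : ∀ {k x} → Ord≥ k x → Ord≥ k (ℚ.- x)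
  Ord≥-neg {k} {x} o = DivPow⇒Ord≥ k (represents-neg x)
    (DivPow-neg _ _ (Ord≥⇒DivPow k (represents-self x) o))

  Ord≥-* : ∀ {a b x y} → Ord≥ a x → Ord≥ b y → Ord≥ (a ℤ.+ b) (x ℚ.* y)
  Ord≥-* {a} {b} {x} {y} ox oy = DivPow⇒Ord≥ (a ℤ.+ b) (represents-* x y)
    (subst (λ M → DivPow M (↥ x ℤ.* ↥ y)) (trans (regroup a b _ _) (cong (λ z → (a ℤ.+ b) ℤ.+ z) (sym (ord↧-* x y))))
      (DivPow-* _ _ _ _ (Ord≥⇒DivPow a (represents-self x) ox) (Ord≥⇒DivPow b (represents-self y) oy)))
    where
    regroup : ∀ a b X Y → (a ℤ.+ X) ℤ.+ (b ℤ.+ Y) ≡ (a ℤ.+ b) ℤ.+ (X ℤ.+ Y)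
    regroup = solve-∀

  Ord≥-+ : ∀ {k x y} → Ord≥ k x → Ord≥ k y → Ord≥ k (x ℚ.+ y)
  Ord≥-+ {k} {x} {y} ox oy = DivPow⇒Ord≥ k (represents-+ x y)
    (subst (λ M → DivPow M _) (cong (λ z → k ℤ.+ z) (sym (ord↧-* x y))) (DivPow-+ _ _ _ left right))
    where
    X Y : ℤ
    X = + ord (↧ₙ x)
    Y = + ord (↧ₙ y)
    reassoc : ∀ k X Y → k ℤ.+ X ℤ.+ Y ≡ k ℤ.+ (X ℤ.+ Y)
    reassoc = solve-∀
    reassoc' : ∀ k X Y → k ℤ.+ Y ℤ.+ X ≡ k ℤ.+ (X ℤ.+ Y)
    reassoc' = solve-∀
    -- each cross term carries the other denominator, of valuation ≥ 0
    left : DivPow (k ℤ.+ (X ℤ.+ Y)) (↥ x ℤ.* ↧ y)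
    left = subst (λ M → DivPow M _) (reassoc k X Y)
             (DivPow-* _ _ _ _ (Ord≥⇒DivPow k (represents-self x) ox) (inj₂ ℤP.≤-refl))
    right : DivPow (k ℤ.+ (X ℤ.+ Y)) (↥ y ℤ.* ↧ x)
    right = subst (λ M → DivPow M _) (reassoc' k X Y)
              (DivPow-* _ _ _ _ (Ord≥⇒DivPow k (represents-self y) oy) (inj₂ ℤP.≤-refl))

  Ord≥-- : ∀ {k x y} → Ord≥ k x → Ord≥ k y → Ord≥ k (x ℚ.- y)
  Ord≥-- ox oy = Ord≥-+ ox (Ord≥-neg oy)

  Ord≥-fromℤ : ∀ k z → DivPow k z → Ord≥ k (fromℤ z)
  Ord≥-fromℤ k z dk = DivPow⇒Ord≥ k (represents-fromℤ z)
    (subst (λ M → DivPow M z) (sym (trans (cong (λ o → k ℤ.+ + o) ord-1) (ℤP.+-identityʳ k))) dk)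

  ordℚ-* : ∀ x y → x ≢ 0ℚ → y ≢ 0ℚ → ordℚ p (x ℚ.* y) ≡ ordℚ p x ℤ.+ ordℚ p y
  ordℚ-* x y x≢0 y≢0 = begin
    ordℚ p (x ℚ.* y)
      ≡⟨ represents-ord (represents-* x y) nxy≢0 ⟩
    + ordℤ (↥ x ℤ.* ↥ y) ℤ.- + ord (↧ₙ x ℕ.* ↧ₙ y)
      ≡⟨ cong₂ (λ u v → + u ℤ.- v) (ordℤ-* _ _ (↥≢0 x x≢0) (↥≢0 y y≢0)) (ord↧-* x y) ⟩
    (+ ordℤ (↥ x) ℤ.+ + ordℤ (↥ y)) ℤ.- (+ ord (↧ₙ x) ℤ.+ + ord (↧ₙ y))
      ≡⟨ regroup (+ ordℤ (↥ x)) (+ ordℤ (↥ y)) (+ ord (↧ₙ x)) (+ ord (↧ₙ y)) ⟩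
    ordℚ p x ℤ.+ ordℚ p y ∎
    where
    open ≡-Reasoning
    nxy≢0 : ↥ x ℤ.* ↥ y ≢ 0ℤ
    nxy≢0 e = [ ↥≢0 x x≢0 , ↥≢0 y y≢0 ]′ (ℤP.i*j≡0⇒i≡0∨j≡0 (↥ x) e)
    regroup : ∀ A B C D → (A ℤ.+ B) ℤ.- (C ℤ.+ D) ≡ (A ℤ.- C) ℤ.+ (B ℤ.- D)
    regroup = solve-∀

  ordℚ-1 : ordℚ p 1ℚ ≡ 0ℤ
  ordℚ-1 = cong₂ (λ a b → + a ℤ.- + b) ord-1 ord-1

  ordℚ-inv : ∀ x → x ≢ 0ℚ → ordℚ p (inv x) ≡ ℤ.- ordℚ p x
  ordℚ-inv x x≢0 = sum0⇒neg (ordℚ p x) (ordℚ p (inv x))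
    (trans (sym (ordℚ-* x (inv x) x≢0 (inv≢0 x x≢0))) (trans (cong (ordℚ p) (inv-inverseʳ x x≢0)) ordℚ-1))
    where
    sum0⇒neg : ∀ a b → a ℤ.+ b ≡ 0ℤ → b ≡ ℤ.- a
    sum0⇒neg a b e = trans (r₁ a b) (trans (cong (ℤ._- a) e) (r₂ a))
      where
      r₁ : ∀ a b → b ≡ (a ℤ.+ b) ℤ.- a
      r₁ = solve-∀
      r₂ : ∀ a → 0ℤ ℤ.- a ≡ ℤ.- a
      r₂ = solve-∀

  Ord≥-inv : ∀ x → x ≢ 0ℚ → Ord≥ (ℤ.- ordℚ p x) (inv x)
  Ord≥-inv x x≢0 = inj₂ (ℤP.≤-reflexive (sym (ordℚ-inv x x≢0)))

  pℚ : ℚ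
  pℚ = fromℤ (+ p)

  pℚ-pos : 0ℚ ℚ.< pℚ
  pℚ-pos = fromℤ-mono-< (ℤ.+<+ (ℕP.≤-trans (ℕ.s≤s ℕ.z≤n) p≥2))

  powℕ-1 : powℕ p 1 ≡ pℚ
  powℕ-1 = cong (λ z → fromℤ (+ z)) (ℕP.*-identityʳ p)

  powℕ-suc : ∀ n → powℕ p (suc n) ≡ powℕ p n ℚ.* pℚ
  powℕ-suc n = trans (cong (λ z → fromℤ (+ z)) (ℕP.*-comm p (p ℕ.^ n)))
                     (trans (cong fromℤ (ℤP.pos-* (p ℕ.^ n) p)) (fromℤ-* (+ (p ℕ.^ n)) (+ p)))

  powℕ-pos : ∀ n → 0ℚ ℚ.< powℕ p n
  powℕ-pos n = fromℤ-mono-< (ℤ.+<+ (ℕP.m^n>0 p n))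

  ppow-pos : ∀ e → 0ℚ ℚ.< ppow p e
  ppow-pos (+ n) = powℕ-pos n
  ppow-pos -[1+ n ] = inv-pos _ (powℕ-pos (suc n))

  ppow≢0 : ∀ e → ppow p e ≢ 0ℚ
  ppow≢0 e = pos⇒≢0 (ppow-pos e)

  ppow-suc : ∀ e → ppow p (e ℤ.+ + 1) ≡ ppow p e ℚ.* pℚ
  ppow-suc (+ n) = trans (cong (powℕ p) (ℕP.+-comm n 1)) (powℕ-suc n)
  ppow-suc -[1+ zero ] = trans (sym (inv-inverseˡ pℚ (pos⇒≢0 pℚ-pos))) (cong (λ z → inv z ℚ.* pℚ) (sym powℕ-1))
  ppow-suc -[1+ suc n ] = begin
    inv pⁿ⁺¹                                ≡⟨ sym (ℚP.*-identityʳ _) ⟩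
    inv pⁿ⁺¹ ℚ.* 1ℚ                         ≡⟨ cong (inv pⁿ⁺¹ ℚ.*_) (sym (inv-inverseˡ pℚ (pos⇒≢0 pℚ-pos))) ⟩
    inv pⁿ⁺¹ ℚ.* (inv pℚ ℚ.* pℚ)            ≡⟨ sym (ℚP.*-assoc (inv pⁿ⁺¹) (inv pℚ) pℚ) ⟩
    (inv pⁿ⁺¹ ℚ.* inv pℚ) ℚ.* pℚ            ≡⟨ cong (ℚ._* pℚ) (sym (inv-* pⁿ⁺¹ pℚ (ppow≢0 (+ suc n)) (pos⇒≢0 pℚ-pos))) ⟩
    inv (pⁿ⁺¹ ℚ.* pℚ) ℚ.* pℚ                ≡⟨ cong (λ z → inv z ℚ.* pℚ) (sym (powℕ-suc (suc n))) ⟩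
    inv (powℕ p (suc (suc n))) ℚ.* pℚ       ∎
    where
    open ≡-Reasoning
    pⁿ⁺¹ : ℚ
    pⁿ⁺¹ = powℕ p (suc n)

  ppow-+ : ∀ e n → ppow p (e ℤ.+ + n) ≡ ppow p e ℚ.* powℕ p n
  ppow-+ e zero = trans (cong (ppow p) (ℤP.+-identityʳ e)) (sym (ℚP.*-identityʳ (ppow p e)))
  ppow-+ e (suc n) = begin
    ppow p (e ℤ.+ + suc n)              ≡⟨ cong (λ m → ppow p (e ℤ.+ + m)) (ℕP.+-comm 1 n) ⟩
    ppow p (e ℤ.+ (+ n ℤ.+ + 1))        ≡⟨ cong (ppow p) (sym (ℤP.+-assoc e (+ n) (+ 1))) ⟩
    ppow p ((e ℤ.+ + n) ℤ.+ + 1)        ≡⟨ ppow-suc (e ℤ.+ + n) ⟩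
    ppow p (e ℤ.+ + n) ℚ.* pℚ           ≡⟨ cong (ℚ._* pℚ) (ppow-+ e n) ⟩
    (ppow p e ℚ.* powℕ p n) ℚ.* pℚ      ≡⟨ ℚP.*-assoc (ppow p e) (powℕ p n) pℚ ⟩
    ppow p e ℚ.* (powℕ p n ℚ.* pℚ)      ≡⟨ cong (ppow p e ℚ.*_) (sym (powℕ-suc n)) ⟩
    ppow p e ℚ.* powℕ p (suc n)         ∎
    where open ≡-Reasoning

  ppow-neg-inverse : ∀ e → ppow p (ℤ.- e) ℚ.* ppow p e ≡ 1ℚ
  ppow-neg-inverse +0 = refl
  ppow-neg-inverse +[1+ n ] = inv-inverseˡ _ (ppow≢0 (+ suc n))
  ppow-neg-inverse -[1+ n ] = inv-inverseʳ _ (ppow≢0 (+ suc n))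

  split-ppow : ∀ x e → x ≡ (x ℚ.* ppow p (ℤ.- e)) ℚ.* ppow p e
  split-ppow x e = begin
    x                                       ≡⟨ sym (ℚP.*-identityʳ x) ⟩
    x ℚ.* 1ℚ                                ≡⟨ cong (x ℚ.*_) (sym (ppow-neg-inverse e)) ⟩
    x ℚ.* (ppow p (ℤ.- e) ℚ.* ppow p e)     ≡⟨ sym (ℚP.*-assoc x _ _) ⟩
    (x ℚ.* ppow p (ℤ.- e)) ℚ.* ppow p e     ∎
    where open ≡-Reasoning

  ordℚ-ppow : ∀ e → ordℚ p (ppow p e) ≡ e
  ordℚ-ppow (+ n) rewrite fromℤ-mk (+ (p ℕ.^ n)) =
    trans (cong₂ (λ a b → + a ℤ.- + b) (ord-^ n) ord-1) (ℤP.+-identityʳ (+ n))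
  ordℚ-ppow -[1+ n ] = trans (ordℚ-inv _ (ppow≢0 (+ suc n))) (cong ℤ.-_ (ordℚ-ppow (+ suc n)))

  Ord≥-ppow : ∀ e → Ord≥ e (ppow p e)
  Ord≥-ppow e = inj₂ (ℤP.≤-reflexive (sym (ordℚ-ppow e)))

  -- a ≤ b gives b = a + n with n : ℕ, reducing monotonicity to ppow-+
  ≤⇒+ℕ : ∀ a b → a ℤ.≤ b → Σ ℕ λ n → b ≡ a ℤ.+ + n
  ≤⇒+ℕ a b le = ℤ.∣ b ℤ.- a ∣ , trans (shift a b) (cong (λ z → a ℤ.+ z) (sym (ℤP.0≤i⇒+∣i∣≡i (ℤP.i≤j⇒0≤j-i le))))
    where
    shift : ∀ a b → b ≡ a ℤ.+ (b ℤ.- a)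
    shift = solve-∀

  ppow-mono-≤ : ∀ {a b} → a ℤ.≤ b → ppow p a ℚ.≤ ppow p b
  ppow-mono-≤ {a} {b} le with ≤⇒+ℕ a b le
  ... | n , refl = subst₂ ℚ._≤_ (ℚP.*-identityʳ (ppow p a)) (sym (ppow-+ a n))
    (ℚP.*-monoˡ-≤-nonNeg (ppow p a) {{ℚ.nonNegative (ℚP.<⇒≤ (ppow-pos a))}} (fromℤ-mono-≤ (ℤ.+≤+ (ℕP.m^n>0 p n))))

  ppow-mono-< : ∀ {a b} → a ℤ.< b → ppow p a ℚ.< ppow p b
  ppow-mono-< {a} {b} lt with ≤⇒+ℕ (a ℤ.+ + 1) b (subst (ℤ._≤ b) (ℤP.+-comm (+ 1) a) (ℤP.i<j⇒suc[i]≤j lt))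
  ... | n , refl = subst₂ ℚ._<_ (ℚP.*-identityʳ (ppow p a)) (sym (trans (cong (ppow p) (ℤP.+-assoc a (+ 1) (+ n))) (ppow-+ a (suc n))))
    (ℚP.*-monoʳ-<-pos (ppow p a) {{ℚ.positive (ppow-pos a)}} 1<pⁿ⁺¹)
    where
    1<pⁿ⁺¹ : 1ℚ ℚ.< powℕ p (suc n)
    1<pⁿ⁺¹ = fromℤ-mono-< (ℤ.+<+ (ℕP.^-monoʳ-< p (ℕP.≤-trans (ℕ.s≤s (ℕ.s≤s ℕ.z≤n)) p≥2) {0} {suc n} (ℕ.s≤s ℕ.z≤n)))

  absp-nonzero : ∀ x → x ≢ 0ℚ → absp p x ≡ ppow p (ℤ.- ordℚ p x)
  absp-nonzero x x≢0 with x ℚP.≟ 0ℚ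
  ... | yes e = ⊥-elim (x≢0 e)
  ... | no _ = refl

  0≤absp : ∀ y → y ≢ 0ℚ → 0ℚ ℚ.≤ absp p y
  0≤absp y y≢0 = subst (0ℚ ℚ.≤_) (sym (absp-nonzero y y≢0)) (ℚP.<⇒≤ (ppow-pos (ℤ.- ordℚ p y)))

  Ord≥⇒absp-≤ : ∀ x y → y ≢ 0ℚ → Ord≥ (ordℚ p y) x → absp p x ℚ.≤ absp p y
  Ord≥⇒absp-≤ x y y≢0 (inj₁ refl) = 0≤absp y y≢0
  Ord≥⇒absp-≤ x y y≢0 (inj₂ le) = by-cases (x ℚP.≟ 0ℚ)
    where
    by-cases : Dec (x ≡ 0ℚ) → absp p x ℚ.≤ absp p y
    by-cases (yes refl) = 0≤absp y y≢0
    by-cases (no x≢0) = subst₂ ℚ._≤_ (sym (absp-nonzero x x≢0)) (sym (absp-nonzero y y≢0))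
                               (ppow-mono-≤ (ℤP.neg-mono-≤ le))

  absp-≤⇒Ord≥ : ∀ x y → y ≢ 0ℚ → absp p x ℚ.≤ absp p y → Ord≥ (ordℚ p y) x
  absp-≤⇒Ord≥ x y y≢0 le = by-cases (x ℚP.≟ 0ℚ)
    where
    by-cases : Dec (x ≡ 0ℚ) → Ord≥ (ordℚ p y) x
    by-cases (yes e) = inj₁ e
    by-cases (no x≢0) with ordℚ p y ℤP.≤? ordℚ p x
    ... | yes l = inj₂ l
    ... | no nl = ⊥-elim (ℚP.<-irrefl refl (ℚP.<-≤-trans |y|<|x| le))
      where
      |y|<|x| : absp p y ℚ.< absp p x
      |y|<|x| = subst₂ ℚ._<_ (sym (absp-nonzero y y≢0)) (sym (absp-nonzero x x≢0))
                  (ppow-mono-< (ℤP.neg-mono-< (ℤP.≰⇒> nl)))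

  InZ : ℚ → Set
  InZ = InZ[1/p] p

  represents⇒↧∣ : ∀ {x n d} → Represents x n d → ↧ₙ x ℕD.∣ d
  represents⇒↧∣ {x@(mkℚ nx _ c)} {n} {d} (_ , eq) =
    NC.coprime-divisor (NC.sym (NC.recompute c))
      (ℕD.divides ℤ.∣ n ∣ (trans (sym (ℤP.abs-* nx (+ d))) (trans (cong ℤ.∣_∣ eq) (ℤP.abs-* n (↧ x)))))

  InZ-fromℤ : ∀ z → InZ (fromℤ z)
  InZ-fromℤ z = 0 , subst (ℕD._∣ 1) (sym (↧-fromℤ z)) ℕD.∣-refl

  InZ-* : ∀ {x y} → InZ x → InZ y → InZ (x ℚ.* y)
  InZ-* {x} {y} (a , da) (b , db) = a ℕ.+ b , ℕD.∣-trans (represents⇒↧∣ (represents-* x y))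
    (subst (ℕD._∣_ (↧ₙ x ℕ.* ↧ₙ y)) (sym (ℕP.^-distribˡ-+-* p a b)) (ℕD.*-pres-∣ da db))

  InZ-+ : ∀ {x y} → InZ x → InZ y → InZ (x ℚ.+ y)
  InZ-+ {x} {y} (a , da) (b , db) = a ℕ.+ b , ℕD.∣-trans (represents⇒↧∣ (represents-+ x y))
    (subst (ℕD._∣_ (↧ₙ x ℕ.* ↧ₙ y)) (sym (ℕP.^-distribˡ-+-* p a b)) (ℕD.*-pres-∣ da db))

  InZ-- : ∀ {x y} → InZ x → InZ y → InZ (x ℚ.- y)
  InZ-- {x} {y} ix (b , db) = InZ-+ {x} {ℚ.- y} ix (b , ℕD.∣-trans (represents⇒↧∣ (represents-neg y)) db)

  *powℕ≡fromℤ⇒InZ : ∀ x m c → x ℚ.* powℕ p m ≡ fromℤ c → InZ x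
  *powℕ≡fromℤ⇒InZ x m c eq = m , represents⇒↧∣ {x} {c} (ℕ.≢-nonZero⁻¹ _ {{ℕP.m^n≢0 p m}} , x≡c/pᵐ)
    where
    pᵐ : ℚ
    pᵐ = powℕ p m
    cross : ↥ (fromℤ c) ℤ.* + (↧ₙ x ℕ.* ↧ₙ pᵐ) ≡ (↥ x ℤ.* ↥ pᵐ) ℤ.* ↧ (fromℤ c)
    cross = subst (λ z → ↥ z ℤ.* + (↧ₙ x ℕ.* ↧ₙ pᵐ) ≡ (↥ x ℤ.* ↥ pᵐ) ℤ.* ↧ z) eq
                  (Represents.cross-multiply (represents-* x pᵐ))
    cross' : c ℤ.* + (↧ₙ x ℕ.* 1) ≡ (↥ x ℤ.* + (p ℕ.^ m)) ℤ.* + 1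
    cross' = trans (cong₂ (λ u v → u ℤ.* + (↧ₙ x ℕ.* v)) (sym (↥-fromℤ c)) (sym (↧-fromℤ (+ (p ℕ.^ m)))))
               (trans cross (cong₂ (λ u v → (↥ x ℤ.* u) ℤ.* + v) (↥-fromℤ (+ (p ℕ.^ m))) (↧-fromℤ c)))
    x≡c/pᵐ : ↥ x ℤ.* + (p ℕ.^ m) ≡ c ℤ.* ↧ x
    x≡c/pᵐ = sym (trans (cong (λ v → c ℤ.* + v) (sym (ℕP.*-identityʳ (↧ₙ x)))) (trans cross' (ℤP.*-identityʳ _)))

  InZ-ppow : ∀ e → InZ (ppow p e)
  InZ-ppow (+ n) = InZ-fromℤ (+ (p ℕ.^ n))
  InZ-ppow -[1+ n ] = *powℕ≡fromℤ⇒InZ (ppow p -[1+ n ]) (suc n) (+ 1) (inv-inverseˡ (powℕ p (suc n)) (ppow≢0 (+ suc n)))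

  Ord≥0⇒p∤↧ : ∀ w → Ord≥ 0ℤ w → ¬ (p ℕD.∣ ↧ₙ w)
  Ord≥0⇒p∤↧ w (inj₁ refl) p∣1 = ℕP.<-irrefl refl (ℕP.≤-trans p≥2 (ℕD.∣⇒≤ p∣1))
  Ord≥0⇒p∤↧ w@(mkℚ nw dw c) (inj₂ le) p∣↧ = ℕP.<-irrefl refl (ℕP.≤-trans p≥2 (ℕP.≤-reflexive (NC.recompute c (p∣↥ , p∣↧))))
    where
    ord↧≤ord↥ : ord (suc dw) ℕ.≤ ordℤ nw
    ord↧≤ord↥ = ℤP.drop‿+≤+ (≤-⇒+≤ 0ℤ (+ ord (suc dw)) (+ ordℤ nw) le)
    1≤ord↧ : 1 ℕ.≤ ord (suc dw)
    1≤ord↧ = dvd⇒≤ord (suc dw) 1 (λ ()) (subst (ℕD._∣ suc dw) (sym (ℕP.*-identityʳ p)) p∣↧)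
    p∣↥ : p ℕD.∣ ℤ.∣ nw ∣
    p∣↥ = ℕD.∣-trans (subst (ℕD._∣ p ℕ.^ ordℤ nw) (ℕP.*-identityʳ p) (^-mono-∣ 1 (ordℤ nw) (ℕP.≤-trans 1≤ord↧ ord↧≤ord↥)))
                     (ord-dvd _)

  InZ∧Ord≥0⇒integer : ∀ y → InZ y → Ord≥ 0ℤ y → y ≡ fromℤ (↥ y)
  InZ∧Ord≥0⇒integer y _ (inj₁ refl) = refl
  InZ∧Ord≥0⇒integer y@(mkℚ ny dy c) (a , da) o@(inj₂ _) =
    trans (sym (ℚP.↥p/↧p≡p y)) (ℚP./-cong {ny} {suc dy} {ny} {1} refl (p∤∧∣pᵃ⇒≡1 (suc dy) a (Ord≥0⇒p∤↧ y o) da))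

  InZ∧Ord≥⇒multiple : ∀ x k → InZ x → Ord≥ k x → Σ ℤ λ m → x ≡ fromℤ m ℚ.* ppow p k
  InZ∧Ord≥⇒multiple x k ix ox = ↥ y , trans (split-ppow x k) (cong (ℚ._* ppow p k) (InZ∧Ord≥0⇒integer y iy oy))
    where
    y : ℚ
    y = x ℚ.* ppow p (ℤ.- k)
    iy : InZ y
    iy = InZ-* {x} {ppow p (ℤ.- k)} ix (InZ-ppow (ℤ.- k))
    oy : Ord≥ 0ℤ y
    oy = subst (λ z → Ord≥ z y) (ℤP.+-inverseʳ k) (Ord≥-* ox (Ord≥-ppow (ℤ.- k)))

  -- For a p-integral w the digit c = digit0 p w satisfies
  -- w ≡ c (mod p); hence shift w = (w - c)/p is again p-integral, and
  -- unrolling n steps gives  w = Σ_{j<n} c_j p^j + p^n · (shiftⁿ w).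

  bezout : ∀ d → ¬ (p ℕD.∣ d) → Σ ℤ λ X → Σ ℤ λ Y → X ℤ.* + d ≡ + 1 ℤ.+ + p ℤ.* Y
  bezout d p∤d with NC.coprime-Bézout (p∤⇒coprime d p∤d)
  ... | Bézout.+- x y eq = + x , + y , trans (sym (ℤP.pos-* x d)) (trans (cong +_ (sym eq))
          (cong (λ z → + 1 ℤ.+ z) (trans (ℤP.pos-* y p) (ℤP.*-comm (+ y) (+ p)))))
  ... | Bézout.-+ x y eq = ℤ.- + x , ℤ.- + y , negate (+ x) (+ d) (+ y) (+ p)
          (trans (cong (λ z → + 1 ℤ.+ z) (sym (ℤP.pos-* x d))) (trans (cong +_ eq) (ℤP.pos-* y p)))
    where
    negate : ∀ a b c e → + 1 ℤ.+ a ℤ.* b ≡ c ℤ.* e → (ℤ.- a) ℤ.* b ≡ + 1 ℤ.+ e ℤ.* (ℤ.- c)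
    negate a b c e h = trans (r₁ a b) (trans (cong (λ z → + 1 ℤ.- z) h) (r₂ c e))
      where
      r₁ : ∀ a b → (ℤ.- a) ℤ.* b ≡ + 1 ℤ.- (+ 1 ℤ.+ a ℤ.* b)
      r₁ = solve-∀
      r₂ : ∀ c e → + 1 ℤ.- c ℤ.* e ≡ + 1 ℤ.+ e ℤ.* (ℤ.- c)
      r₂ = solve-∀

  -- "c is the residue of w = n/d modulo p":  p ∣ n - c·d
  IsDigit : ℚ → ℕ → Set
  IsDigit w c = p ℕD.∣ ℤ.∣ ↥ w ℤ.- + c ℤ.* + ↧ₙ w ∣

  isDigit? : ∀ w c → Dec (IsDigit w c)
  isDigit? w c = p ℕD.∣? ℤ.∣ ↥ w ℤ.- + c ℤ.* + ↧ₙ w ∣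

  -- a residue exists: c = (n·X) mod p where X inverts d modulo p
  digit-exists : ∀ w → Ord≥ 0ℤ w → Σ ℕ λ c → (c ℕ.< p) × IsDigit w c
  digit-exists w ow with bezout (↧ₙ w) (Ord≥0⇒p∤↧ w ow)
  ... | X , Y , Xd≡1+pY = c , ℤD.n%d<d (↥ w ℤ.* X) (+ p) ,
        ℤS.∣⇒∣ᵤ {+ p} (ℤS.divides (q ℤ.* + ↧ₙ w ℤ.- ↥ w ℤ.* Y) (residue (↥ w) X Y (+ ↧ₙ w) (+ c) q (+ p) Xd≡1+pY nX≡c+qp))
    where
    c : ℕ
    c = (↥ w ℤ.* X) ℤD.% (+ p)
    q : ℤ
    q = (↥ w ℤ.* X) ℤD./ (+ p)
    nX≡c+qp : ↥ w ℤ.* X ≡ + c ℤ.+ q ℤ.* + p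
    nX≡c+qp = ℤD.a≡a%n+[a/n]*n (↥ w ℤ.* X) (+ p)
    residue : ∀ n X Y d c q P → X ℤ.* d ≡ + 1 ℤ.+ P ℤ.* Y → n ℤ.* X ≡ c ℤ.+ q ℤ.* P →
              n ℤ.- c ℤ.* d ≡ (q ℤ.* d ℤ.- n ℤ.* Y) ℤ.* P
    residue n X Y d c q P e₁ e₂ = begin
      n ℤ.- c ℤ.* d                                 ≡⟨ cong (λ z → n ℤ.- z ℤ.* d) c≡ ⟩
      n ℤ.- (n ℤ.* X ℤ.- q ℤ.* P) ℤ.* d             ≡⟨ r₁ n X q P d ⟩
      n ℤ.- n ℤ.* (X ℤ.* d) ℤ.+ q ℤ.* P ℤ.* d       ≡⟨ cong (λ z → n ℤ.- n ℤ.* z ℤ.+ q ℤ.* P ℤ.* d) e₁ ⟩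
      n ℤ.- n ℤ.* (+ 1 ℤ.+ P ℤ.* Y) ℤ.+ q ℤ.* P ℤ.* d ≡⟨ r₂ n P Y q d ⟩
      (q ℤ.* d ℤ.- n ℤ.* Y) ℤ.* P                   ∎
      where
      open ≡-Reasoning
      r₀ : ∀ c q P → c ≡ (c ℤ.+ q ℤ.* P) ℤ.- q ℤ.* P
      r₀ = solve-∀
      c≡ : c ≡ n ℤ.* X ℤ.- q ℤ.* P
      c≡ = trans (r₀ c q P) (cong (ℤ._- q ℤ.* P) (sym e₂))
      r₁ : ∀ n X q P d → n ℤ.- (n ℤ.* X ℤ.- q ℤ.* P) ℤ.* d ≡ n ℤ.- n ℤ.* (X ℤ.* d) ℤ.+ q ℤ.* P ℤ.* d
      r₁ = solve-∀
      r₂ : ∀ n P Y q d → n ℤ.- n ℤ.* (+ 1 ℤ.+ P ℤ.* Y) ℤ.+ q ℤ.* P ℤ.* d ≡ (q ℤ.* d ℤ.- n ℤ.* Y) ℤ.* P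
      r₂ = solve-∀

  digit0-isDigit : ∀ w → Ord≥ 0ℤ w → IsDigit w (digit0 p w)
  digit0-isDigit w ow = search-witness (isDigit? w) p (proj₁ residue) (proj₁ (proj₂ residue)) (proj₂ (proj₂ residue))
    where
    residue : Σ ℕ λ c → (c ℕ.< p) × IsDigit w c
    residue = digit-exists w ow

  Ord≥1-w-digit0 : ∀ w → Ord≥ 0ℤ w → Ord≥ (+ 1) (w ℚ.- fromℤ (+ digit0 p w))
  Ord≥1-w-digit0 w ow = subst (Ord≥ (+ 1)) (sym w-c≡z/d) (Ord≥-* (Ord≥-fromℤ (+ 1) z p∣z) 1/d-integral)
    where
    c : ℕ
    c = digit0 p w
    z : ℤ
    z = ↥ w ℤ.- + c ℤ.* ↧ w
    p∣z : DivPow (+ 1) z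
    p∣z = ∣⇒DivPow 1 z (subst (ℕD._∣ ℤ.∣ z ∣) (sym (ℕP.*-identityʳ p)) (digit0-isDigit w ow))
    D : ℚ
    D = fromℤ (↧ w)
    D≢0 : D ≢ 0ℚ
    D≢0 e = ℕP.1+n≢0 (ℤP.+-injective (fromℤ-injective {↧ w} {0ℤ} e))
    1/d-integral : Ord≥ 0ℤ (inv D)
    1/d-integral = inj₂ (ℤP.≤-reflexive (sym (trans (ordℚ-inv D D≢0)
      (cong ℤ.-_ (trans (cong₂ (λ a b → + a ℤ.- + b) (cong ord (cong ℤ.∣_∣ (↥-fromℤ (↧ w)))) (cong ord (↧-fromℤ (↧ w))))
        (cong₂ (λ a b → + a ℤ.- + b) (p∤⇒ord≡0 (↧ₙ w) (Ord≥0⇒p∤↧ w ow)) ord-1))))))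
    fc : ℚ
    fc = fromℤ (+ c)
    w-c≡z/d : w ℚ.- fc ≡ fromℤ z ℚ.* inv D
    w-c≡z/d = begin
      w ℚ.- fc                           ≡⟨ sym (*-inv-cancel D (w ℚ.- fc) D≢0) ⟩
      (D ℚ.* (w ℚ.- fc)) ℚ.* inv D       ≡⟨ cong (ℚ._* inv D) (solve 3 (λ D w f → D :* (w :- f) := w :* D :- f :* D) refl D w fc) ⟩
      (w ℚ.* D ℚ.- fc ℚ.* D) ℚ.* inv D   ≡⟨ cong (ℚ._* inv D) (cong₂ ℚ._-_ (*-denominator w) (sym (fromℤ-* (+ c) (↧ w)))) ⟩
      (fromℤ (↥ w) ℚ.- fromℤ (+ c ℤ.* ↧ w)) ℚ.* inv D ≡⟨ cong (ℚ._* inv D) (sym (fromℤ-- (↥ w) (+ c ℤ.* ↧ w))) ⟩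
      fromℤ z ℚ.* inv D                  ∎
      where open ≡-Reasoning

  shift : ℚ → ℚ
  shift w = (w ℚ.- fromℤ (+ digit0 p w)) ℚ.* inv (powℕ p 1)

  shiftⁿ : ℕ → ℚ → ℚ
  shiftⁿ zero w = w
  shiftⁿ (suc n) w = shiftⁿ n (shift w)

  Ord≥0-shiftⁿ : ∀ n w → Ord≥ 0ℤ w → Ord≥ 0ℤ (shiftⁿ n w)
  Ord≥0-shiftⁿ zero w ow = ow
  Ord≥0-shiftⁿ (suc n) w ow = Ord≥0-shiftⁿ n (shift w) (Ord≥-* (Ord≥1-w-digit0 w ow) (Ord≥-ppow -[1+ 0 ]))

  w-digit0≡p*shift : ∀ w → w ℚ.- fromℤ (+ digit0 p w) ≡ pℚ ℚ.* shift w
  w-digit0≡p*shift w = begin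
    a                                      ≡⟨ sym (*-inv-cancel (powℕ p 1) a (ppow≢0 (+ 1))) ⟩
    (powℕ p 1 ℚ.* a) ℚ.* inv (powℕ p 1)    ≡⟨ ℚP.*-assoc (powℕ p 1) a (inv (powℕ p 1)) ⟩
    powℕ p 1 ℚ.* shift w                   ≡⟨ cong (ℚ._* shift w) powℕ-1 ⟩
    pℚ ℚ.* shift w                         ∎
    where
    open ≡-Reasoning
    a : ℚ
    a = w ℚ.- fromℤ (+ digit0 p w)

  digitSum : ℕ → ℚ → ℚ
  digitSum n w = sumTo n (λ j → fromℤ (+ digits p w j) ℚ.* powℕ p j)

  w-digitSum : ∀ n w → w ℚ.- digitSum n w ≡ powℕ p n ℚ.* shiftⁿ n w
  w-digitSum zero w = solve 1 (λ w → w :- con 0ℚ := con 1ℚ :* w) refl w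
  w-digitSum (suc n) w = begin
    w ℚ.- digitSum (suc n) w                          ≡⟨ cong (λ z → w ℚ.- z) (sumTo-suc n f) ⟩
    w ℚ.- (f 0 ℚ.+ sumTo n (λ j → f (suc j)))         ≡⟨ cong (λ z → w ℚ.- (f 0 ℚ.+ z)) tail ⟩
    w ℚ.- (c₀ ℚ.* 1ℚ ℚ.+ pℚ ℚ.* digitSum n sw)        ≡⟨ solve 4 (λ w d P s → w :- (d :* con 1ℚ :+ P :* s) := (w :- d) :- P :* s) refl w c₀ pℚ (digitSum n sw) ⟩
    (w ℚ.- c₀) ℚ.- pℚ ℚ.* digitSum n sw               ≡⟨ cong (ℚ._- pℚ ℚ.* digitSum n sw) (w-digit0≡p*shift w) ⟩
    pℚ ℚ.* sw ℚ.- pℚ ℚ.* digitSum n sw                ≡⟨ solve 3 (λ P a b → P :* a :- P :* b := P :* (a :- b)) refl pℚ sw (digitSum n sw) ⟩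
    pℚ ℚ.* (sw ℚ.- digitSum n sw)                     ≡⟨ cong (pℚ ℚ.*_) (w-digitSum n sw) ⟩
    pℚ ℚ.* (powℕ p n ℚ.* shiftⁿ n sw)                 ≡⟨ solve 3 (λ P a b → P :* (a :* b) := (a :* P) :* b) refl pℚ (powℕ p n) (shiftⁿ n sw) ⟩
    (powℕ p n ℚ.* pℚ) ℚ.* shiftⁿ n sw                 ≡⟨ cong (ℚ._* shiftⁿ n sw) (sym (powℕ-suc n)) ⟩
    powℕ p (suc n) ℚ.* shiftⁿ (suc n) w               ∎
    where
    open ≡-Reasoning
    f : ℕ → ℚ
    f j = fromℤ (+ digits p w j) ℚ.* powℕ p j
    sw c₀ : ℚ
    sw = shift w
    c₀ = fromℤ (+ digit0 p w)
    -- digits p w (suc j) = digits p sw j, so the tail is p times the sum for sw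
    tail : sumTo n (λ j → f (suc j)) ≡ pℚ ℚ.* digitSum n sw
    tail = trans (sumTo-cong n _ _ (λ j → trans (cong (fromℤ (+ digits p sw j) ℚ.*_) (powℕ-suc j))
                   (solve 3 (λ a b c → a :* (b :* c) := c :* (a :* b)) refl (fromℤ (+ digits p sw j)) (powℕ p j) pℚ)))
                 (sumTo-*ˡ n pℚ (λ j → fromℤ (+ digits p sw j) ℚ.* powℕ p j))

  module Truncation (k : ℤ) (x : ℚ) (x≢0 : x ≢ 0ℚ) where
    e : ℤ
    e = ordℚ p x
    u : ℚ
    u = x ℚ.* ppow p (ℤ.- e)
    K : ℕ
    K = clip (k ℤ.- e)
    term : ℕ → ℚ
    term j = fromℤ (+ digits p u j) ℚ.* ppow p (e ℤ.+ + j)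

    trunc≡sum : trunc p k x ≡ sumTo K term
    trunc≡sum with x ℚP.≟ 0ℚ
    ... | yes x≡0 = ⊥-elim (x≢0 x≡0)
    ... | no _ = refl

    trunc≡pᵉ*digitSum : trunc p k x ≡ ppow p e ℚ.* digitSum K u
    trunc≡pᵉ*digitSum = trans trunc≡sum (trans (sumTo-cong K _ _ (λ j → trans (cong (fromℤ (+ digits p u j) ℚ.*_) (ppow-+ e j))
      (solve 3 (λ a b c → a :* (b :* c) := b :* (a :* c)) refl (fromℤ (+ digits p u j)) (ppow p e) (powℕ p j))))
      (sumTo-*ˡ K (ppow p e) (λ j → fromℤ (+ digits p u j) ℚ.* powℕ p j)))

    u-unit : Ord≥ 0ℤ u
    u-unit = inj₂ (ℤP.≤-reflexive (sym (trans (ordℚ-* x (ppow p (ℤ.- e)) x≢0 (ppow≢0 (ℤ.- e)))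
               (trans (cong (λ z → e ℤ.+ z) (ordℚ-ppow (ℤ.- e))) (ℤP.+-inverseʳ e)))))

    x-trunc≡ : x ℚ.- trunc p k x ≡ ppow p e ℚ.* (powℕ p K ℚ.* shiftⁿ K u)
    x-trunc≡ = begin
      x ℚ.- trunc p k x                         ≡⟨ cong₂ ℚ._-_ (trans (split-ppow x e) (ℚP.*-comm u (ppow p e))) trunc≡pᵉ*digitSum ⟩
      ppow p e ℚ.* u ℚ.- ppow p e ℚ.* digitSum K u ≡⟨ solve 3 (λ P a b → P :* a :- P :* b := P :* (a :- b)) refl (ppow p e) u (digitSum K u) ⟩
      ppow p e ℚ.* (u ℚ.- digitSum K u)         ≡⟨ cong (ppow p e ℚ.*_) (w-digitSum K u) ⟩
      ppow p e ℚ.* (powℕ p K ℚ.* shiftⁿ K u)    ∎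
      where open ≡-Reasoning

    k≤e+K : k ℤ.≤ e ℤ.+ (+ K ℤ.+ 0ℤ)
    k≤e+K = subst₂ ℤ._≤_ (cancel e k) (cong (λ z → e ℤ.+ z) (sym (ℤP.+-identityʳ (+ K)))) (ℤP.+-monoʳ-≤ e (≤clip (k ℤ.- e)))
      where
      cancel : ∀ e k → e ℤ.+ (k ℤ.- e) ≡ k
      cancel = solve-∀
      ≤clip : ∀ z → z ℤ.≤ + clip z
      ≤clip (+ n) = ℤP.≤-refl
      ≤clip -[1+ n ] = ℤ.-≤+

    Ord≥-x-trunc : Ord≥ k (x ℚ.- trunc p k x)
    Ord≥-x-trunc = subst (Ord≥ k) (sym x-trunc≡)
      (Ord≥-mono k≤e+K (Ord≥-* (Ord≥-ppow e) (Ord≥-* (Ord≥-ppow (+ K)) (Ord≥0-shiftⁿ K u u-unit))))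

    InZ-trunc : InZ (trunc p k x)
    InZ-trunc = subst InZ (sym trunc≡sum) (InZ-sum K term (λ j → InZ-* {fromℤ (+ digits p u j)} {ppow p (e ℤ.+ + j)}
                                                                    (InZ-fromℤ (+ digits p u j)) (InZ-ppow (e ℤ.+ + j))))
      where
      InZ-sum : ∀ n f → (∀ j → InZ (f j)) → InZ (sumTo n f)
      InZ-sum zero f h = InZ-fromℤ 0ℤ
      InZ-sum (suc n) f h = InZ-+ {sumTo n f} {f n} (InZ-sum n f h) (h n)

  ultrametric : ∀ k y z → z ≢ 0ℚ → Ord≥ k (y ℚ.- z) → ordℚ p z ℤ.< k → (y ≢ 0ℚ) × (ordℚ p y ≡ ordℚ p z)
  ultrametric k y z z≢0 oy-z oz<k = y≢0 , ℤP.≤-antisym upper lower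
    where
    oz : ℤ
    oz = ordℚ p z
    z≡y-[y-z] : z ≡ y ℚ.- (y ℚ.- z)
    z≡y-[y-z] = solve 2 (λ y z → z := y :- (y :- z)) refl y z
    y≡[y-z]+z : y ≡ (y ℚ.- z) ℚ.+ z
    y≡[y-z]+z = solve 2 (λ y z → y := (y :- z) :+ z) refl y z
    y≢0 : y ≢ 0ℚ
    y≢0 refl = [ z≢0 , (λ k≤oz → ℤP.<-irrefl refl (ℤP.<-≤-trans oz<k k≤oz)) ]′ oz≥k
      where
      oz≥k : Ord≥ k z
      oz≥k = subst (Ord≥ k) (solve 1 (λ z → :- (con 0ℚ :- z) := z) refl z) (Ord≥-neg oy-z)
    lower : oz ℤ.≤ ordℚ p y
    lower = [ (λ y≡0 → ⊥-elim (y≢0 y≡0)) , (λ l → l) ]′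
              (subst (Ord≥ oz) (sym y≡[y-z]+z) (Ord≥-+ (Ord≥-mono (ℤP.<⇒≤ oz<k) oy-z) (Ord≥-refl z)))
    upper : ordℚ p y ℤ.≤ oz
    upper with ordℚ p y ℤP.≤? oz
    ... | yes l = l
    ... | no nl = ⊥-elim ([ z≢0 , (λ l → ℤP.<-irrefl refl (ℤP.suc[i]≤j⇒i<j (subst (ℤ._≤ oz) (ℤP.+-comm oz (+ 1)) l))) ]′ oz≥oz+1)
      where
      -- both y and y - z have ord ≥ oz + 1, hence so does z
      oz+1≤oy : oz ℤ.+ + 1 ℤ.≤ ordℚ p y
      oz+1≤oy = subst (ℤ._≤ ordℚ p y) (ℤP.+-comm (+ 1) oz) (ℤP.i<j⇒suc[i]≤j (ℤP.≰⇒> nl))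
      oz+1≤k : oz ℤ.+ + 1 ℤ.≤ k
      oz+1≤k = subst (ℤ._≤ k) (ℤP.+-comm (+ 1) oz) (ℤP.i<j⇒suc[i]≤j oz<k)
      oz≥oz+1 : Ord≥ (oz ℤ.+ + 1) z
      oz≥oz+1 = subst (Ord≥ (oz ℤ.+ + 1)) (sym z≡y-[y-z]) (Ord≥-- {x = y} (inj₂ oz+1≤oy) (Ord≥-mono oz+1≤k oy-z))

  -- Before step i both procedures are described by ζ = ζᵢ, B = b·q₀⋯q_{i-1}
  -- and R = r_{i-1} = ζ·B.  IsDivision k B R q r are the conditions that
  -- define the p^k-division  B = R·q - r  of procedure (2).

  record State (k : ℤ) (ζ B R : ℚ) : Set where
    field
      ζ≢0     : ζ ≢ 0ℚ
      B≢0     : B ≢ 0ℚ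
      ζB≡R    : ζ ℚ.* B ≡ R
      R-pos   : 0ℚ ℚ.< R
      InZ-R   : InZ R
      InZ-B   : InZ B
      -ordζ<k : ℤ.- ordℚ p ζ ℤ.< k

  IsDivision : ℤ → (B R q r : ℚ) → Set
  IsDivision k B R q r =
    InZ q × InZ r × (B ≡ R ℚ.* q ℚ.- r) × (0ℚ ℚ.≤ r) × (r ℚ.< R ℚ.* ppow p k)
    × (absp p r ℚ.≤ absp p (R ℚ.* ppow p k))

  module DivisionStep (k : ℤ) {ζ B R : ℚ} (s : State k ζ B R) where
    open State s

    pᵏ t x q r : ℚ
    pᵏ = ppow p k
    t = trunc p k (inv ζ)
    x = (1ℚ ℚ.- t ℚ.* ζ) ℚ.* inv (pᵏ ℚ.* ζ)
    q = sylQ p k ζ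
    r = R ℚ.* q ℚ.- B

    c : ℤ
    c = ceiling x

    R≢0 : R ≢ 0ℚ
    R≢0 = pos⇒≢0 R-pos

    Rpᵏ-pos : 0ℚ ℚ.< R ℚ.* pᵏ
    Rpᵏ-pos = *-pos R pᵏ R-pos (ppow-pos k)

    instance
      Rpᵏ-positive : ℚ.Positive (R ℚ.* pᵏ)
      Rpᵏ-positive = ℚ.positive Rpᵏ-pos
      Rpᵏ-nonNegative : ℚ.NonNegative (R ℚ.* pᵏ)
      Rpᵏ-nonNegative = ℚ.nonNegative (ℚP.<⇒≤ Rpᵏ-pos)

    ordℚ-Rpᵏ : ordℚ p (R ℚ.* pᵏ) ≡ ordℚ p R ℤ.+ k
    ordℚ-Rpᵏ = trans (ordℚ-* R pᵏ R≢0 (ppow≢0 k)) (cong (λ z → ordℚ p R ℤ.+ z) (ordℚ-ppow k))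

    R/ζ≡B : R ℚ.* inv ζ ≡ B
    R/ζ≡B = trans (cong (ℚ._* inv ζ) (sym ζB≡R)) (*-inv-cancel ζ B ζ≢0)

    remainder-gap : ∀ q' → R ℚ.* q' ℚ.- B ≡ R ℚ.* (q' ℚ.- inv ζ)
    remainder-gap q' = trans (cong (λ z → R ℚ.* q' ℚ.- z) (sym R/ζ≡B))
      (solve 3 (λ R q i → R :* q :- R :* i := R :* (q :- i)) refl R q' (inv ζ))

    remainder-formula : ∀ m → R ℚ.* (t ℚ.+ fromℤ m ℚ.* pᵏ) ℚ.- B ≡ (R ℚ.* pᵏ) ℚ.* (fromℤ m ℚ.- x)
    remainder-formula m = begin
      R ℚ.* (t ℚ.+ fromℤ m ℚ.* pᵏ) ℚ.- B
        ≡⟨ solve 5 (λ R t m P B → R :* (t :+ m :* P) :- B := R :* P :* m :- (B :- t :* R)) refl R t (fromℤ m) pᵏ B ⟩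
      R ℚ.* pᵏ ℚ.* fromℤ m ℚ.- (B ℚ.- t ℚ.* R)
        ≡⟨ cong (λ z → R ℚ.* pᵏ ℚ.* fromℤ m ℚ.- z) (sym Rpᵏx≡B-tR) ⟩
      R ℚ.* pᵏ ℚ.* fromℤ m ℚ.- R ℚ.* pᵏ ℚ.* x
        ≡⟨ solve 3 (λ a m x → a :* m :- a :* x := a :* (m :- x)) refl (R ℚ.* pᵏ) (fromℤ m) x ⟩
      (R ℚ.* pᵏ) ℚ.* (fromℤ m ℚ.- x) ∎
      where
      open ≡-Reasoning
      x·pᵏζ≡1-tζ : x ℚ.* (pᵏ ℚ.* ζ) ≡ 1ℚ ℚ.- t ℚ.* ζ
      x·pᵏζ≡1-tζ = trans (ℚP.*-assoc (1ℚ ℚ.- t ℚ.* ζ) (inv (pᵏ ℚ.* ζ)) (pᵏ ℚ.* ζ))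
        (trans (cong ((1ℚ ℚ.- t ℚ.* ζ) ℚ.*_) (inv-inverseˡ (pᵏ ℚ.* ζ) (*≢0 pᵏ ζ (ppow≢0 k) ζ≢0)))
               (ℚP.*-identityʳ (1ℚ ℚ.- t ℚ.* ζ)))
      Rpᵏx≡B-tR : R ℚ.* pᵏ ℚ.* x ≡ B ℚ.- t ℚ.* R
      Rpᵏx≡B-tR = begin
        R ℚ.* pᵏ ℚ.* x
          ≡⟨ sym (ℚP.*-identityʳ (R ℚ.* pᵏ ℚ.* x)) ⟩
        R ℚ.* pᵏ ℚ.* x ℚ.* 1ℚ
          ≡⟨ cong (R ℚ.* pᵏ ℚ.* x ℚ.*_) (sym (inv-inverseˡ ζ ζ≢0)) ⟩
        R ℚ.* pᵏ ℚ.* x ℚ.* (inv ζ ℚ.* ζ)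
          ≡⟨ solve 5 (λ R P x i z → R :* P :* x :* (i :* z) := (R :* i) :* (x :* (P :* z))) refl R pᵏ x (inv ζ) ζ ⟩
        (R ℚ.* inv ζ) ℚ.* (x ℚ.* (pᵏ ℚ.* ζ))
          ≡⟨ cong₂ ℚ._*_ R/ζ≡B x·pᵏζ≡1-tζ ⟩
        B ℚ.* (1ℚ ℚ.- t ℚ.* ζ)
          ≡⟨ solve 3 (λ B t z → B :* (con 1ℚ :- t :* z) := B :- t :* (z :* B)) refl B t ζ ⟩
        B ℚ.- t ℚ.* (ζ ℚ.* B)
          ≡⟨ cong (λ w → B ℚ.- t ℚ.* w) ζB≡R ⟩
        B ℚ.- t ℚ.* R ∎

    window⇒ceiling : ∀ m → 0ℚ ℚ.≤ (R ℚ.* pᵏ) ℚ.* (fromℤ m ℚ.- x) → (R ℚ.* pᵏ) ℚ.* (fromℤ m ℚ.- x) ℚ.< R ℚ.* pᵏ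
                     → ceiling x ≡ m
    window⇒ceiling m lo hi = ceiling-unique x m (0≤-⇒≤ x (fromℤ m) m-x≥0) (-<1⇒<+1 x (fromℤ m) m-x<1)
      where
      m-x≥0 : 0ℚ ℚ.≤ fromℤ m ℚ.- x
      m-x≥0 = ℚP.*-cancelˡ-≤-pos (R ℚ.* pᵏ) (subst (ℚ._≤ (R ℚ.* pᵏ) ℚ.* (fromℤ m ℚ.- x)) (sym (ℚP.*-zeroʳ (R ℚ.* pᵏ))) lo)
      m-x<1 : fromℤ m ℚ.- x ℚ.< 1ℚ
      m-x<1 = ℚP.*-cancelˡ-<-nonNeg (R ℚ.* pᵏ) (subst ((R ℚ.* pᵏ) ℚ.* (fromℤ m ℚ.- x) ℚ.<_) (sym (ℚP.*-identityʳ (R ℚ.* pᵏ))) hi)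

    ceiling⇒window : (0ℚ ℚ.≤ (R ℚ.* pᵏ) ℚ.* (fromℤ c ℚ.- x)) × ((R ℚ.* pᵏ) ℚ.* (fromℤ c ℚ.- x) ℚ.< R ℚ.* pᵏ)
    ceiling⇒window =
        subst (ℚ._≤ (R ℚ.* pᵏ) ℚ.* (fromℤ c ℚ.- x)) (ℚP.*-zeroʳ (R ℚ.* pᵏ))
              (ℚP.*-monoˡ-≤-nonNeg (R ℚ.* pᵏ) (≤⇒0≤- x (fromℤ c) (proj₁ (ceiling-spec x))))
      , subst ((R ℚ.* pᵏ) ℚ.* (fromℤ c ℚ.- x) ℚ.<_) (ℚP.*-identityʳ (R ℚ.* pᵏ))
              (ℚP.*-monoʳ-<-pos (R ℚ.* pᵏ) (<+1⇒-<1 x (fromℤ c) (proj₂ (ceiling-spec x))))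

    open Truncation k (inv ζ) (inv≢0 ζ ζ≢0) using (Ord≥-x-trunc; InZ-trunc)

    -- q agrees with 1/ζ to order k, hence (ultrametric) has ord_p q = -ord_p ζ
    q-close : Ord≥ k (q ℚ.- inv ζ)
    q-close = subst (Ord≥ k) (solve 3 (λ t cP i → cP :- (i :- t) := (t :+ cP) :- i) refl t (fromℤ c ℚ.* pᵏ) (inv ζ))
      (Ord≥-- (subst (λ z → Ord≥ z (fromℤ c ℚ.* pᵏ)) (ℤP.+-identityˡ k)
                (Ord≥-* (Ord≥-fromℤ 0ℤ c (DivPow-nonPos 0ℤ c ℤP.≤-refl)) (Ord≥-ppow k)))
              Ord≥-x-trunc)

    q≢0∧ordq : (q ≢ 0ℚ) × (ordℚ p q ≡ ordℚ p (inv ζ))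
    q≢0∧ordq = ultrametric k q (inv ζ) (inv≢0 ζ ζ≢0) q-close (subst (ℤ._< k) (sym (ordℚ-inv ζ ζ≢0)) -ordζ<k)

    q≢0 : q ≢ 0ℚ
    q≢0 = proj₁ q≢0∧ordq

    r-formula : r ≡ (R ℚ.* pᵏ) ℚ.* (fromℤ c ℚ.- x)
    r-formula = remainder-formula c

    Ord≥-r : Ord≥ (ordℚ p R ℤ.+ k) r
    Ord≥-r = subst (Ord≥ (ordℚ p R ℤ.+ k)) (sym (remainder-gap q)) (Ord≥-* (Ord≥-refl R) q-close)

    InZ-q : InZ q
    InZ-q = InZ-+ {t} {fromℤ c ℚ.* pᵏ} InZ-trunc (InZ-* {fromℤ c} {pᵏ} (InZ-fromℤ c) (InZ-ppow k))

    InZ-r : InZ r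
    InZ-r = InZ-- {R ℚ.* q} {B} (InZ-* {R} {q} InZ-R InZ-q) InZ-B

    division-exists : IsDivision k B R q r
    division-exists = InZ-q , InZ-r , solve 2 (λ a B → B := a :- (a :- B)) refl (R ℚ.* q) B
                    , subst (0ℚ ℚ.≤_) (sym r-formula) (proj₁ ceiling⇒window)
                    , subst (ℚ._< R ℚ.* pᵏ) (sym r-formula) (proj₂ ceiling⇒window)
                    , Ord≥⇒absp-≤ r (R ℚ.* pᵏ) (pos⇒≢0 Rpᵏ-pos) (subst (λ z → Ord≥ z r) (sym ordℚ-Rpᵏ) Ord≥-r)

    -- Its quotient q' is within p^k of 1/ζ, hence of t, so q' = t + m·p^k
    -- for an integer m, and the bounds on r' force m = ⌈x⌉.
    division-unique : ∀ q' r' → IsDivision k B R q' r' → q' ≡ q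
    division-unique q' r' (InZ-q' , InZ-r' , B≡ , r'≥0 , r'<Rpᵏ , |r'|≤) =
      trans q'≡t+mpᵏ (cong (λ z → t ℚ.+ fromℤ z ℚ.* pᵏ) (sym c≡m))
      where
      r'≡ : r' ≡ R ℚ.* q' ℚ.- B
      r'≡ = trans (solve 2 (λ a r → r := a :- (a :- r)) refl (R ℚ.* q') r') (cong (λ z → R ℚ.* q' ℚ.- z) (sym B≡))
      Ord≥-r' : Ord≥ (ordℚ p R ℤ.+ k) r'
      Ord≥-r' = subst (λ z → Ord≥ z r') ordℚ-Rpᵏ (absp-≤⇒Ord≥ r' (R ℚ.* pᵏ) (pos⇒≢0 Rpᵏ-pos) |r'|≤)
      q'-1/ζ≡r'/R : q' ℚ.- inv ζ ≡ r' ℚ.* inv R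
      q'-1/ζ≡r'/R = trans (sym (*-inv-cancel R (q' ℚ.- inv ζ) R≢0))
                          (cong (ℚ._* inv R) (sym (trans r'≡ (remainder-gap q'))))
      q'-close : Ord≥ k (q' ℚ.- inv ζ)
      q'-close = subst₂ Ord≥ (cancel (ordℚ p R) k) (sym q'-1/ζ≡r'/R) (Ord≥-* Ord≥-r' (Ord≥-inv R R≢0))
        where
        cancel : ∀ a k → (a ℤ.+ k) ℤ.+ ℤ.- a ≡ k
        cancel = solve-∀
      q'-t-close : Ord≥ k (q' ℚ.- t)
      q'-t-close = subst (Ord≥ k) (solve 3 (λ q i t → (q :- i) :+ (i :- t) := q :- t) refl q' (inv ζ) t)
                         (Ord≥-+ q'-close Ord≥-x-trunc)
      multiple : Σ ℤ λ m → q' ℚ.- t ≡ fromℤ m ℚ.* pᵏ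
      multiple = InZ∧Ord≥⇒multiple (q' ℚ.- t) k (InZ-- {q'} {t} InZ-q' InZ-trunc) q'-t-close
      m : ℤ
      m = proj₁ multiple
      q'≡t+mpᵏ : q' ≡ t ℚ.+ fromℤ m ℚ.* pᵏ
      q'≡t+mpᵏ = trans (solve 2 (λ q t → q := t :+ (q :- t)) refl q' t) (cong (t ℚ.+_) (proj₂ multiple))
      r'≡Rpᵏ[m-x] : r' ≡ (R ℚ.* pᵏ) ℚ.* (fromℤ m ℚ.- x)
      r'≡Rpᵏ[m-x] = trans r'≡ (trans (cong (λ z → R ℚ.* z ℚ.- B) q'≡t+mpᵏ) (remainder-formula m))
      c≡m : c ≡ m
      c≡m = window⇒ceiling m (subst (0ℚ ℚ.≤_) r'≡Rpᵏ[m-x] r'≥0) (subst (ℚ._< R ℚ.* pᵏ) r'≡Rpᵏ[m-x] r'<Rpᵏ)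

    ζ' B' : ℚ
    ζ' = ζ ℚ.- inv q
    B' = B ℚ.* q

    ζ'B'≡r : ζ' ℚ.* B' ≡ r
    ζ'B'≡r = begin
      (ζ ℚ.- inv q) ℚ.* (B ℚ.* q)                 ≡⟨ solve 4 (λ z i B q → (z :- i) :* (B :* q) := (z :* B) :* q :- B :* (i :* q)) refl ζ (inv q) B q ⟩
      (ζ ℚ.* B) ℚ.* q ℚ.- B ℚ.* (inv q ℚ.* q)     ≡⟨ cong₂ (λ u v → u ℚ.* q ℚ.- B ℚ.* v) ζB≡R (inv-inverseˡ q q≢0) ⟩
      R ℚ.* q ℚ.- B ℚ.* 1ℚ                        ≡⟨ cong (λ w → R ℚ.* q ℚ.- w) (ℚP.*-identityʳ B) ⟩
      r                                           ∎
      where open ≡-Reasoning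

    B'≢0 : B' ≢ 0ℚ
    B'≢0 = *≢0 B q B≢0 q≢0

    ζ'≡r/B' : ζ' ≡ r ℚ.* inv B'
    ζ'≡r/B' = trans (sym (*-inv-cancel B' ζ' B'≢0)) (cong (ℚ._* inv B') (trans (ℚP.*-comm B' ζ') ζ'B'≡r))

    -- the invariant -ord ζ' < k persists:
    --   -ord ζ' = -ord r + ord B + ord q ≤ -(ord ζ + ord B + k) + ord B - ord ζ < k
    next-ord : r ≢ 0ℚ → ℤ.- ordℚ p ζ' ℤ.< k
    next-ord r≢0 = subst (λ w → ℤ.- w ℤ.< k) (sym ordζ') (bound (ordℚ p ζ) (ordℚ p B) (ordℚ p r) -ordζ<k ordr≥)
      where
      ordζ' : ordℚ p ζ' ≡ ordℚ p r ℤ.+ ℤ.- (ordℚ p B ℤ.+ ℤ.- ordℚ p ζ)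
      ordζ' = begin
        ordℚ p ζ'                                     ≡⟨ cong (ordℚ p) ζ'≡r/B' ⟩
        ordℚ p (r ℚ.* inv B')                         ≡⟨ ordℚ-* r (inv B') r≢0 (inv≢0 B' B'≢0) ⟩
        ordℚ p r ℤ.+ ordℚ p (inv B')                  ≡⟨ cong (λ w → ordℚ p r ℤ.+ w) (ordℚ-inv B' B'≢0) ⟩
        ordℚ p r ℤ.+ ℤ.- ordℚ p B'                    ≡⟨ cong (λ w → ordℚ p r ℤ.+ ℤ.- w) (ordℚ-* B q B≢0 q≢0) ⟩
        ordℚ p r ℤ.+ ℤ.- (ordℚ p B ℤ.+ ordℚ p q)      ≡⟨ cong (λ w → ordℚ p r ℤ.+ ℤ.- (ordℚ p B ℤ.+ w)) (trans (proj₂ q≢0∧ordq) (ordℚ-inv ζ ζ≢0)) ⟩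
        ordℚ p r ℤ.+ ℤ.- (ordℚ p B ℤ.+ ℤ.- ordℚ p ζ)  ∎
        where open ≡-Reasoning
      ordR≡ : ordℚ p R ≡ ordℚ p ζ ℤ.+ ordℚ p B
      ordR≡ = trans (cong (ordℚ p) (sym ζB≡R)) (ordℚ-* ζ B ζ≢0 B≢0)
      ordr≥ : (ordℚ p ζ ℤ.+ ordℚ p B) ℤ.+ k ℤ.≤ ordℚ p r
      ordr≥ = [ (λ e → ⊥-elim (r≢0 e)) , subst (λ w → w ℤ.+ k ℤ.≤ ordℚ p r) ordR≡ ]′ Ord≥-r
      bound : ∀ z b A → ℤ.- z ℤ.< k → (z ℤ.+ b) ℤ.+ k ℤ.≤ A → ℤ.- (A ℤ.+ ℤ.- (b ℤ.+ ℤ.- z)) ℤ.< k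
      bound z b A -z<k le = ℤP.≤-<-trans step₁ (ℤP.<-trans (subst ((ℤ.- z) ℤ.+ ((ℤ.- z) ℤ.- k) ℤ.<_) (r₂ k z) step₂) -z<k)
        where
        r₀ : ∀ A b z → ℤ.- (A ℤ.+ ℤ.- (b ℤ.+ ℤ.- z)) ≡ ℤ.- A ℤ.+ (b ℤ.- z)
        r₀ = solve-∀
        r₁ : ∀ z b k → ℤ.- ((z ℤ.+ b) ℤ.+ k) ℤ.+ (b ℤ.- z) ≡ (ℤ.- z) ℤ.+ ((ℤ.- z) ℤ.- k)
        r₁ = solve-∀
        r₂ : ∀ k z → k ℤ.+ ((ℤ.- z) ℤ.- k) ≡ ℤ.- z
        r₂ = solve-∀
        step₁ : ℤ.- (A ℤ.+ ℤ.- (b ℤ.+ ℤ.- z)) ℤ.≤ (ℤ.- z) ℤ.+ ((ℤ.- z) ℤ.- k)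
        step₁ = subst₂ ℤ._≤_ (sym (r₀ A b z)) (r₁ z b k) (ℤP.+-monoˡ-≤ (b ℤ.- z) (ℤP.neg-mono-≤ le))
        step₂ : (ℤ.- z) ℤ.+ ((ℤ.- z) ℤ.- k) ℤ.< k ℤ.+ ((ℤ.- z) ℤ.- k)
        step₂ = ℤP.+-monoˡ-< ((ℤ.- z) ℤ.- k) -z<k

    next : (r ≡ 0ℚ × ζ' ≡ 0ℚ) ⊎ State k ζ' B' r
    next with r ℚP.≟ 0ℚ
    ... | yes r≡0 = inj₁ (r≡0 , trans ζ'≡r/B' (trans (cong (ℚ._* inv B') r≡0) (ℚP.*-zeroˡ (inv B'))))
    ... | no r≢0 = inj₂ record
      { ζ≢0 = λ ζ'≡0 → r≢0 (trans (sym ζ'B'≡r) (trans (cong (ℚ._* B') ζ'≡0) (ℚP.*-zeroˡ B')))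
      ; B≢0 = B'≢0
      ; ζB≡R = ζ'B'≡r
      ; R-pos = nonNeg∧≢0⇒pos (proj₁ (proj₂ (proj₂ (proj₂ division-exists)))) r≢0
      ; InZ-R = InZ-r
      ; InZ-B = InZ-* {B} {q} InZ-B InZ-q
      ; -ordζ<k = next-ord r≢0
      }

subst₃ : ∀ {A B C : Set} (P : A → B → C → Set) {x x' y y' z z'} →
         x ≡ x' → y ≡ y' → z ≡ z' → P x y z → P x' y' z'
subst₃ P refl refl refl s = s

isZero-≢0 : ∀ x → x ≢ 0ℚ → isZero x ≡ false
isZero-≢0 x x≢0 with x ℚP.≟ 0ℚ
... | yes x≡0 = ⊥-elim (x≢0 x≡0)
... | no _ = refl

output-stopped : ∀ x (a : ℚ) → x ≡ 0ℚ → (if isZero x then nothing else just a) ≡ nothing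
output-stopped x a refl = refl

output-running : ∀ x (a : ℚ) → x ≢ 0ℚ → (if isZero x then nothing else just a) ≡ just a
output-running x a x≢0 = cong (λ z → if z then nothing else just a) (isZero-≢0 x x≢0)

sylStep-stopped : ∀ p k → sylStep p k 0ℚ ≡ 0ℚ
sylStep-stopped p k = refl

sylStep-running : ∀ p k x → x ≢ 0ℚ → sylStep p k x ≡ x ℚ.- inv (sylQ p k x)
sylStep-running p k x x≢0 = cong (λ z → if z then 0ℚ else x ℚ.- inv (sylQ p k x)) (isZero-≢0 x x≢0)

module Lockstep (p : ℕ) (pr : Prime p) (ζ : ℚ) (ζ≢0 : ζ ≢ 0ℚ) (a b : ℤ) (a>0 : a ℤ.> + 0)
                (ζb≡a : ζ ℚ.* fromℤ b ≡ fromℤ a) (k : ℤ) (-ordζ<k : k ℤ.> ℤ.- ordℚ p ζ) where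
  open PAdic p pr

  Z : ℕ → ℚ
  Z = sylZeta p k ζ

  Bq : (ℕ → ℚ) → ℕ → ℚ
  Bq q i = fromℤ b ℚ.* prodTo i q

  Bq-suc : ∀ q i → Bq q (suc i) ≡ Bq q i ℚ.* q i
  Bq-suc q i = sym (ℚP.*-assoc (fromℤ b) (prodTo i q) (q i))

  InLockstep : (q R : ℕ → ℚ) → ℕ → Set
  InLockstep q R i = (R i ≡ 0ℚ × Z i ≡ 0ℚ) ⊎ State k (Z i) (Bq q i) (R i)

  FollowsDivision : (q R : ℕ → ℚ) → Set
  FollowsDivision q R = ∀ i (s : State k (Z i) (Bq q i) (R i)) →
    (q i ≡ DivisionStep.q k s) × (R (suc i) ≡ DivisionStep.r k s)

  initial-state : ∀ (q R : ℕ → ℚ) → R 0 ≡ fromℤ a → State k ζ (Bq q 0) (R 0)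
  initial-state q R R0≡a = record
    { ζ≢0 = ζ≢0
    ; B≢0 = λ B≡0 → pos⇒≢0 a-pos (trans (sym ζB≡a) (trans (cong (ζ ℚ.*_) B≡0) (ℚP.*-zeroʳ ζ)))
    ; ζB≡R = trans ζB≡a (sym R0≡a)
    ; R-pos = subst (0ℚ ℚ.<_) (sym R0≡a) a-pos
    ; InZ-R = subst InZ (sym R0≡a) (InZ-fromℤ a)
    ; InZ-B = InZ-* {fromℤ b} {1ℚ} (InZ-fromℤ b) (InZ-fromℤ (+ 1))
    ; -ordζ<k = -ordζ<k
    }
    where
    a-pos : 0ℚ ℚ.< fromℤ a
    a-pos = fromℤ-mono-< {+ 0} {a} a>0
    ζB≡a : ζ ℚ.* Bq q 0 ≡ fromℤ a
    ζB≡a = trans (cong (ζ ℚ.*_) (ℚP.*-identityʳ (fromℤ b))) ζb≡a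

  module _ (q R : ℕ → ℚ) (start : R 0 ≡ fromℤ a)
           (stay : ∀ i → R i ≡ 0ℚ → Z i ≡ 0ℚ → R (suc i) ≡ 0ℚ) (follow : FollowsDivision q R) where

    lockstep : ∀ i → InLockstep q R i
    lockstep zero = inj₂ (initial-state q R start)
    lockstep (suc i) with lockstep i
    ... | inj₁ (R≡0 , Z≡0) = inj₁ (stay i R≡0 Z≡0 , trans (cong (sylStep p k) Z≡0) (sylStep-stopped p k))
    ... | inj₂ s with DivisionStep.next k s | follow i s
    ...   | inj₁ (r≡0 , ζ'≡0) | _ , R≡r = inj₁ (trans R≡r r≡0 , trans (sylStep-running p k (Z i) (State.ζ≢0 s)) ζ'≡0)
    ...   | inj₂ s' | q≡ , R≡r = inj₂ (subst₃ (State k) (sym (sylStep-running p k (Z i) (State.ζ≢0 s)))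
                                         (trans (cong (Bq q i ℚ.*_) (sym q≡)) (sym (Bq-suc q i))) (sym R≡r) s')

    outputs-agree : ∀ i → greedyOut q R i ≡ sylOut p k ζ i
    outputs-agree i with lockstep i
    ... | inj₁ (R≡0 , Z≡0) = trans (output-stopped (R i) (q i) R≡0) (sym (output-stopped (Z i) (sylQ p k (Z i)) Z≡0))
    ... | inj₂ s = trans (output-running (R i) (q i) (pos⇒≢0 (State.R-pos s)))
                         (trans (cong just (proj₁ (follow i s))) (sym (output-running (Z i) (sylQ p k (Z i)) (State.ζ≢0 s))))

  -- procedure (2) follows the division steps, by uniqueness of p^k-division
  greedy-follows : ∀ (q R : ℕ → ℚ) → IsGreedyRun p k a b q R → FollowsDivision q R
  greedy-follows q R (_ , steps , _) i s = q≡ , R≡r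
    where
    open DivisionStep k s using (r; division-unique)
    division : IsDivision k (Bq q i) (R i) (q i) (R (suc i))
    division = steps i (pos⇒≢0 (State.R-pos s))
    q≡ : q i ≡ DivisionStep.q k s
    q≡ = division-unique (q i) (R (suc i)) division
    R≡r : R (suc i) ≡ r
    R≡r = trans (solve 2 (λ x r → r := x :- (x :- r)) refl (R i ℚ.* q i) (R (suc i)))
                (cong₂ (λ u v → u ℚ.- v) (cong (R i ℚ.*_) q≡) (sym (proj₁ (proj₂ (proj₂ division)))))

  -- procedure (1) gives a run of procedure (2): qᵢ = sylQ ζᵢ, rᵢ₋₁ = ζᵢ·Bᵢ
  qS : ℕ → ℚ
  qS i = sylQ p k (Z i)

  RS : ℕ → ℚ
  RS i = Z i ℚ.* Bq qS i

  RS-start : RS 0 ≡ fromℤ a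
  RS-start = trans (cong (ζ ℚ.*_) (ℚP.*-identityʳ (fromℤ b))) ζb≡a

  RS-stay : ∀ i → RS i ≡ 0ℚ → Z i ≡ 0ℚ → RS (suc i) ≡ 0ℚ
  RS-stay i _ Z≡0 = begin
    sylStep p k (Z i) ℚ.* Bq qS (suc i)   ≡⟨ cong (λ z → sylStep p k z ℚ.* Bq qS (suc i)) Z≡0 ⟩
    sylStep p k 0ℚ ℚ.* Bq qS (suc i)      ≡⟨ cong (ℚ._* Bq qS (suc i)) (sylStep-stopped p k) ⟩
    0ℚ ℚ.* Bq qS (suc i)                  ≡⟨ ℚP.*-zeroˡ (Bq qS (suc i)) ⟩
    0ℚ                                    ∎
    where open ≡-Reasoning

  sylvester-follows : FollowsDivision qS RS
  sylvester-follows i s = refl , trans (cong₂ ℚ._*_ (sylStep-running p k (Z i) (State.ζ≢0 s)) (Bq-suc qS i))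
                                       (DivisionStep.ζ'B'≡r k s)

  -- at each live step the division exists; a live R is positive, so never 0
  sylvester-run : IsGreedyRun p k a b qS RS
  sylvester-run = RS-start , steps , stays
    where
    live : ∀ i → InLockstep qS RS i
    live = lockstep qS RS RS-start RS-stay sylvester-follows
    steps : ∀ i → RS i ≢ 0ℚ → GreedyStep p k b qS RS i
    steps i RS≢0 = step-at (live i)
      where
      step-at : InLockstep qS RS i → GreedyStep p k b qS RS i
      step-at (inj₁ (RS≡0 , _)) = ⊥-elim (RS≢0 RS≡0)
      step-at (inj₂ s) = subst₂ (IsDivision k (Bq qS i) (RS i)) (sym (proj₁ (sylvester-follows i s)))
                                (sym (proj₂ (sylvester-follows i s))) (DivisionStep.division-exists k s)
    stays : ∀ i → RS i ≡ 0ℚ → RS (suc i) ≡ 0ℚ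
    stays i RS≡0 = stay-at (live i)
      where
      stay-at : InLockstep qS RS i → RS (suc i) ≡ 0ℚ
      stay-at (inj₁ (_ , Z≡0)) = RS-stay i RS≡0 Z≡0
      stay-at (inj₂ s) = ⊥-elim (pos⇒≢0 (State.R-pos s) RS≡0)

-- Theorem 4.8: procedure (1) and procedure (2) produce the same terms.

theorem4p8 : (p : ℕ) → Prime p →
    (ζ : ℚ) → ¬ (ζ ≡ 0ℚ) →
    (a b : ℤ) → a ℤ.> + 0 → gcd a b ≡ + 1 → ζ ℚ.* fromℤ b ≡ fromℤ a →
    (k : ℤ) → k ℤ.> ℤ.- ordℚ p ζ →
    (Σ[ q ∈ (ℕ → ℚ) ] Σ[ R ∈ (ℕ → ℚ) ]
    (IsGreedyRun p k a b q R × (∀ i → greedyOut q R i ≡ sylOut p k ζ i)))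
    × (∀ (q R : ℕ → ℚ) → IsGreedyRun p k a b q R →
    ∀ i → greedyOut q R i ≡ sylOut p k ζ i)
theorem4p8 p pr ζ ζ≢0 a b a>0 _ ζb≡a k -ordζ<k =
  ( qS , RS , sylvester-run , outputs-agree qS RS RS-start RS-stay sylvester-follows )
  , λ q R run@(start , _ , stays) →
      outputs-agree q R start (λ i R≡0 _ → stays i R≡0) (greedy-follows q R run)
  where open Lockstep p pr ζ ζ≢0 a b a>0 ζb≡a k -ordζ<k
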